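{- Let $M=(E,\mathcal I)$ be a loopless matroid with rank function $r$ and $r(E)>0$, and let $\mathcal B$ be its base family. Then the set of extreme points of $\mathrm{Adm}(\mathcal B)$ is exactly the set $\Theta=\Big\{\tfrac{1}{r(E)-r(E\setminus X)}\mathbf 1_X:\ \emptyset\ne X\subseteq E,\ \mathrm{cl}(E\setminus X)=E\setminus X,\ M/(E\setminus X)\text{ is connected}\Big\}.$
   Context: Bases are identified with their indicator vectors in $\mathbb R^E$; $\mathbf 1_X$ is the indicator vector of $X$. $\mathrm{Adm}(\mathcal B)=\{\rho\in\mathbb R^E_{\ge0}:\sum_{e\in B}\rho(e)\ge1\ \forall B\in\mathcal B\}$ (its set of extreme points is called the Fulkerson blocker family $\widehat{\mathcal B}$). Closure: $\mathrm{cl}(Z)=\{y\in E:r(Z\cup\{y\})=r(Z)\}$. Contraction $M/(E\setminus X)$: matroid on $X$ with rank function $W\mapsto r(W\cup(E\setminus X))-r(E\setminus X)$. A separator of a matroid $N$ on ground set $F$ is a set $Z\subseteq F$ such that every circuit of $N$ is contained in $Z$ or in $F\setminus Z$; $N$ is connected if its only separators are $\emptyset$ and $F$.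
   Formalization: The vectors in Adm(𝓑), the candidate extreme points and the members of Θ are taken in ℚ^E instead of ℝ^E, with rational weights in convex combinations. -}

module Defs where

open import Data.Nat as ℕ using (ℕ; zero; suc; _∸_)
open import Data.Bool using (Bool; true; false; if_then_else_)
open import Data.Fin using (Fin)
open import Data.Vec using (Vec; lookup; tabulate; toList)
open import Data.List using (foldr)
open import Data.Fin.Subset
  using (Subset; _∈_; _⊆_; _∪_; _∩_; ∁; ∣_∣; ⁅_⁆; ⊤; ⊥; Nonempty)
open import Data.Integer using (+_)
open import Data.Rational as ℚ using (ℚ; 0ℚ; 1ℚ; _/_)
open import Data.Product using (Σ; _×_; ∃; ∃-syntax)
open import Data.Sum using (_⊎_)
open import Relation.Nullary using (¬_)
open import Relation.Nullary.Decidable using (⌊_⌋)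
open import Relation.Binary.PropositionalEquality using (_≡_)

record Matroid (n : ℕ) : Set where
  field
    r          : Subset n → ℕ
    r-bounded  : ∀ X → r X ℕ.≤ ∣ X ∣
    r-mono     : ∀ X Y → X ⊆ Y → r X ℕ.≤ r Y
    r-submod   : ∀ X Y → r (X ∪ Y) ℕ.+ r (X ∩ Y) ℕ.≤ r X ℕ.+ r Y

sumOver : {n : ℕ} → Subset n → (Fin n → ℚ) → ℚ
sumOver B ρ = foldr ℚ._+_ 0ℚ (toList (tabulate λ e → if lookup B e then ρ e else 0ℚ))

-- 1/k for k > 0 (the value at 0 is irrelevant: it is never used when r(E) > 0,
-- X ≠ ∅ and E∖X is closed, since then r(E) - r(E∖X) > 0).
inv : ℕ → ℚ
inv zero    = 0ℚ
inv (suc k) = + 1 / suc k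

scaledIndicator : {n : ℕ} → ℚ → Subset n → Fin n → ℚ
scaledIndicator c X e = if lookup X e then c else 0ℚ

IsExtremePoint : {n : ℕ} → ((Fin n → ℚ) → Set) → (Fin n → ℚ) → Set
IsExtremePoint {n} P ρ =
  P ρ × (∀ (ρ₁ ρ₂ : Fin n → ℚ) (t : ℚ) → P ρ₁ → P ρ₂ → 0ℚ ℚ.< t → t ℚ.< 1ℚ →
         (∀ e → ρ e ≡ t ℚ.* ρ₁ e ℚ.+ (1ℚ ℚ.- t) ℚ.* ρ₂ e) →
         ∀ e → ρ₁ e ≡ ρ₂ e)

module _ {n : ℕ} (M : Matroid n) where
  open Matroid M

  Loopless : Set
  Loopless = ∀ (e : Fin n) → r ⁅ e ⁆ ≡ 1

  Independent : Subset n → Set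
  Independent X = r X ≡ ∣ X ∣

  IsBase : Subset n → Set
  IsBase B = Independent B × ∣ B ∣ ≡ r ⊤

  Adm : (Fin n → ℚ) → Set
  Adm ρ = (∀ e → 0ℚ ℚ.≤ ρ e) × (∀ B → IsBase B → 1ℚ ℚ.≤ sumOver B ρ)

  cl : Subset n → Subset n
  cl Z = tabulate λ y → ⌊ r (Z ∪ ⁅ y ⁆) ℕ.≟ r Z ⌋

  -- The contraction M/(E∖X), a matroid on ground set X, via its rank function
  -- W ↦ r(W ∪ (E∖X)) − r(E∖X) for W ⊆ X.
  contrRank : Subset n → Subset n → ℕ
  contrRank X W = r (W ∪ ∁ X) ∸ r (∁ X)

  IsCircuitOfContr : Subset n → Subset n → Set
  IsCircuitOfContr X C =
    C ⊆ X × contrRank X C ℕ.< ∣ C ∣ ×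
    (∀ D → D ⊆ C → ¬ (D ≡ C) → contrRank X D ≡ ∣ D ∣)

  IsSeparatorOfContr : Subset n → Subset n → Set
  IsSeparatorOfContr X Z =
    Z ⊆ X × (∀ C → IsCircuitOfContr X C → C ⊆ Z ⊎ C ⊆ (X ∩ ∁ Z))

  ContrConnected : Subset n → Set
  ContrConnected X = ∀ Z → IsSeparatorOfContr X Z → Z ≡ ⊥ ⊎ Z ≡ X

  InΘ : (Fin n → ℚ) → Set
  InΘ ρ = ∃[ X ] (Nonempty X × cl (∁ X) ≡ ∁ X × ContrConnected X ×
                  (∀ e → ρ e ≡ scaledIndicator (inv (r ⊤ ∸ r (∁ X))) X e))

{-# OPTIONS --safe #-}
module Submission where

-- For X ⊆ E let k = r(E) − r(E∖X), the rank of X in M/(E∖X), and θ_X = 1_X / k.  Every base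
-- meets X in at least k elements, so θ_X is admissible, and the bases meeting X in exactly k
-- elements include all J ∪ I₀ with J a basis of M/(E∖X) and I₀ a fixed basis of E∖X.
--
-- θ_X is extreme when E∖X is closed and M/(E∖X) is connected: in a convex decomposition
-- θ_X = t ρ₁ + (1 − t) ρ₂ both ρᵢ vanish off X and have sum 1 on every such J, so by basis
-- exchange along circuits each ρᵢ is constant on every circuit of M/(E∖X), hence constant on X
-- by connectivity, hence equal to θ_X.
--
-- Conversely let ρ be extreme with support X and minimum v on X.  Every base B contains such a
-- J, so ρ − v 1_X has sum at least 1 − v k on B.  Extremality excludes k = 0 and v k < 1, hence
-- θ_X ≤ ρ and so ρ = θ_X, because an extreme point of an upward closed set dominates no other
-- point of it.  Finally, if E∖X were not closed, or M/(E∖X) had a separator Z ≠ ∅, X, then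
-- θ_X would dominate the scaled indicator of a smaller set, resp. be a proper convex
-- combination of the scaled indicators of Z and X∖Z.

open import Defs
open import Data.Nat using (ℕ; _<_)
open import Data.Rational using (ℚ)
open import Data.Fin using (Fin)
open import Data.Fin.Subset using (⊤)
open import Data.Product using (_×_)

open import Data.Bool using (true; false)
import Data.Fin as Fin
open import Data.Fin.Properties using (any?)
open import Data.Fin.Subset
  using (Subset; _∈_; _∉_; _⊆_; _⊂_; _∪_; _∩_; _─_; _-_; ∁; ∣_∣; ⁅_⁆; ⊥; Nonempty; inside; outside)
open import Data.Fin.Subset.Induction using (Acc; acc; ⊂-wellFounded)
open import Data.Fin.Subset.Properties
open import Data.Integer as ℤ using (+_)
import Data.Integer.Properties as ℤ
open import Data.List.Base using (List; filter; allFin)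
open import Data.List.Membership.Propositional.Properties using (∈-filter⁺; ∈-allFin)
import Data.List.Relation.Unary.All as All
open import Data.List.Relation.Unary.All.Properties using (all-filter)
open import Data.Nat as ℕ using (zero; suc; _∸_; NonZero)
open import Data.Nat.Coprimality using (1-coprimeTo)
import Data.Nat.Properties as ℕ
open import Data.Product using (_,_; ∃-syntax; proj₁; proj₂)
open import Data.Rational as ℚ using (0ℚ; 1ℚ; ½; 1/_)
open import Data.Rational.Literals using (fromℤ)
import Data.Rational.Properties as ℚ
open import Data.Rational.Solver using (module +-*-Solver)
import Data.Rational.Unnormalised as ℚᵘ
import Data.Rational.Unnormalised.Properties as ℚᵘ
open import Data.Sum using (_⊎_; inj₁; inj₂)
open import Data.Vec using ([]; _∷_; here; there; tabulate; lookup)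
open import Data.Vec.Properties using (lookup∘tabulate; []=⇒lookup; lookup⇒[]=)
open import Function using (id; _∘_; case_of_)
open import Level using (Level)
open import Relation.Binary.Bundles using (DecTotalOrder)
open import Relation.Binary.Definitions using (DecidableEquality)
open import Relation.Binary.PropositionalEquality
  using (_≡_; _≢_; refl; sym; trans; cong; cong₂; subst; subst₂; module ≡-Reasoning)
open import Relation.Nullary using (¬_; Dec; yes; no; contradiction; ¬?; _×-dec_)
open import Relation.Nullary.Decidable
  using (⌊_⌋; isYes≗does; dec-true; decidable-stable; from-yes; from-no)
open import Relation.Unary using (Pred; Decidable)

open import Algebra.Properties.Group ℚ.+-0-group using (∙-cancelˡ)
open import Data.List.Extrema (DecTotalOrder.totalOrder ℚ.≤-decTotalOrder)
  using (argmin; argmin-all; f[argmin]≤f[xs])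
open +-*-Solver using (solve; _:+_; _:*_; _:-_; _:=_; con)

private
  variable
    n : ℕ
    ℓ : Level

-- Rational arithmetic

fromℕ : ℕ → ℚ
fromℕ m = fromℤ (+ m)

fromℕ-+ : ∀ a b → fromℕ (a ℕ.+ b) ≡ fromℕ a ℚ.+ fromℕ b
fromℕ-+ a b = ℚ.toℚᵘ-injective
  (ℚᵘ.≃-trans (ℚᵘ.*≡* numerators) (ℚᵘ.≃-sym (ℚ.toℚᵘ-homo-+ (fromℕ a) (fromℕ b))))
  where
  open ≡-Reasoning
  numerators : + (a ℕ.+ b) ℤ.* + 1 ≡ (+ a ℤ.* + 1 ℤ.+ + b ℤ.* + 1) ℤ.* + 1
  numerators = begin
    + (a ℕ.+ b) ℤ.* + 1                    ≡⟨ ℤ.*-identityʳ (+ a ℤ.+ + b) ⟩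
    + a ℤ.+ + b                            ≡⟨ cong₂ ℤ._+_ (ℤ.*-identityʳ (+ a)) (ℤ.*-identityʳ (+ b)) ⟨
    + a ℤ.* + 1 ℤ.+ + b ℤ.* + 1            ≡⟨ ℤ.*-identityʳ _ ⟨
    (+ a ℤ.* + 1 ℤ.+ + b ℤ.* + 1) ℤ.* + 1  ∎

fromℕ-suc : ∀ m → fromℕ (suc m) ≡ 1ℚ ℚ.+ fromℕ m
fromℕ-suc = fromℕ-+ 1

fromℕ-mono-≤ : ∀ {a b} → a ℕ.≤ b → fromℕ a ℚ.≤ fromℕ b
fromℕ-mono-≤ {a} {b} a≤b =
  ℚ.*≤* (subst₂ ℤ._≤_ (sym (ℤ.*-identityʳ (+ a))) (sym (ℤ.*-identityʳ (+ b))) (ℤ.+≤+ a≤b))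

fromℕ-pos : ∀ m .{{_ : NonZero m}} → 0ℚ ℚ.< fromℕ m
fromℕ-pos (suc m) = ℚ.positive⁻¹ (fromℕ (suc m))

inv-*-fromℕ : ∀ c .{{_ : NonZero c}} → inv c ℚ.* fromℕ c ≡ 1ℚ
inv-*-fromℕ (suc c) = trans (cong (ℚ._* fromℕ (suc c)) (ℚ.normalize-coprime (1-coprimeTo (suc c))))
                            (ℚ.*-inverseˡ (fromℕ (suc c)))

inv-pos : ∀ c .{{_ : NonZero c}} → 0ℚ ℚ.< inv c
inv-pos (suc c) = ℚ.positive⁻¹ (inv (suc c)) {{ℚ.normalize-pos 1 (suc c)}}

inv-nonNeg : ∀ c → 0ℚ ℚ.≤ inv c
inv-nonNeg zero    = ℚ.≤-refl
inv-nonNeg (suc c) = ℚ.<⇒≤ (inv-pos (suc c))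

*-fromℕ-*-inv : ∀ v c .{{_ : NonZero c}} → v ℚ.* fromℕ c ℚ.* inv c ≡ v
*-fromℕ-*-inv v c = begin
  v ℚ.* fromℕ c ℚ.* inv c    ≡⟨ reorder v (fromℕ c) (inv c) ⟩
  v ℚ.* (inv c ℚ.* fromℕ c)  ≡⟨ cong (v ℚ.*_) (inv-*-fromℕ c) ⟩
  v ℚ.* 1ℚ                   ≡⟨ ℚ.*-identityʳ v ⟩
  v                          ∎
  where
  open ≡-Reasoning
  reorder : ∀ v m i → v ℚ.* m ℚ.* i ≡ v ℚ.* (i ℚ.* m)
  reorder = solve 3 (λ v m i → v :* m :* i := v :* (i :* m)) refl

*-fromℕ≡1⇒≡inv : ∀ {v} c → v ℚ.* fromℕ c ≡ 1ℚ → v ≡ inv c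
*-fromℕ≡1⇒≡inv {v} zero v*0≡1 with () ← trans (sym (ℚ.*-zeroʳ v)) v*0≡1
*-fromℕ≡1⇒≡inv {v} c@(suc _) v*c≡1 = begin
  v                          ≡⟨ *-fromℕ-*-inv v c ⟨
  v ℚ.* fromℕ c ℚ.* inv c    ≡⟨ cong (ℚ._* inv c) v*c≡1 ⟩
  1ℚ ℚ.* inv c               ≡⟨ ℚ.*-identityˡ (inv c) ⟩
  inv c                      ∎
  where open ≡-Reasoning

inv-≤ : ∀ {v} c .{{_ : NonZero c}} → 1ℚ ℚ.≤ v ℚ.* fromℕ c → inv c ℚ.≤ v
inv-≤ {v} c 1≤v*c = begin
  inv c                          ≡⟨ ℚ.*-identityʳ (inv c) ⟨
  inv c ℚ.* 1ℚ                   ≤⟨ ℚ.*-monoˡ-≤-nonNeg (inv c) {{ℚ.nonNegative (inv-nonNeg c)}} 1≤v*c ⟩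
  inv c ℚ.* (v ℚ.* fromℕ c)      ≡⟨ ℚ.*-comm (inv c) (v ℚ.* fromℕ c) ⟩
  v ℚ.* fromℕ c ℚ.* inv c        ≡⟨ *-fromℕ-*-inv v c ⟩
  v                              ∎
  where open ℚ.≤-Reasoning

complementary-weight : ∀ {a b c} .{{_ : NonZero c}} → a ℕ.+ b ≡ c →
                       1ℚ ℚ.- inv c ℚ.* fromℕ a ≡ inv c ℚ.* fromℕ b
complementary-weight {a} {b} {c} a+b≡c = begin
  1ℚ ℚ.- inv c ℚ.* fromℕ a                              ≡⟨ cong (ℚ._- inv c ℚ.* fromℕ a) (inv-*-fromℕ c) ⟨
  inv c ℚ.* fromℕ c ℚ.- inv c ℚ.* fromℕ a               ≡⟨ cong (λ m → inv c ℚ.* fromℕ m ℚ.- inv c ℚ.* fromℕ a) a+b≡c ⟨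
  inv c ℚ.* fromℕ (a ℕ.+ b) ℚ.- inv c ℚ.* fromℕ a       ≡⟨ cong (λ s → inv c ℚ.* s ℚ.- inv c ℚ.* fromℕ a) (fromℕ-+ a b) ⟩
  inv c ℚ.* (fromℕ a ℚ.+ fromℕ b) ℚ.- inv c ℚ.* fromℕ a ≡⟨ cancel (inv c) (fromℕ a) (fromℕ b) ⟩
  inv c ℚ.* fromℕ b                                     ∎
  where
  open ≡-Reasoning
  cancel : ∀ i a b → i ℚ.* (a ℚ.+ b) ℚ.- i ℚ.* a ≡ i ℚ.* b
  cancel = solve 3 (λ i a b → i :* (a :+ b) :- i :* a := i :* b) refl

0<q-p : ∀ {p q} → p ℚ.< q → 0ℚ ℚ.< q ℚ.- p
0<q-p {p} {q} p<q = subst (ℚ._< q ℚ.- p) (ℚ.+-inverseʳ p) (ℚ.+-monoˡ-< (ℚ.- p) p<q)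

0≤q-p : ∀ {p q} → p ℚ.≤ q → 0ℚ ℚ.≤ q ℚ.- p
0≤q-p {p} {q} p≤q = subst (ℚ._≤ q ℚ.- p) (ℚ.+-inverseʳ p) (ℚ.+-monoˡ-≤ (ℚ.- p) p≤q)

0<q-p⇒p<q : ∀ {p q} → 0ℚ ℚ.< q ℚ.- p → p ℚ.< q
0<q-p⇒p<q {p} {q} 0<q-p = subst₂ ℚ._<_ (ℚ.+-identityˡ p) (cancel q p) (ℚ.+-monoˡ-< p 0<q-p)
  where
  cancel : ∀ q p → q ℚ.- p ℚ.+ p ≡ q
  cancel = solve 2 (λ q p → q :- p :+ p := q) refl

p≤p+q : ∀ {p q} → 0ℚ ℚ.≤ q → p ℚ.≤ p ℚ.+ q
p≤p+q {p} {q} q≥0 = subst (ℚ._≤ p ℚ.+ q) (ℚ.+-identityʳ p) (ℚ.+-monoʳ-≤ p q≥0)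

p-q≤p : ∀ {p q} → 0ℚ ℚ.≤ q → p ℚ.- q ℚ.≤ p
p-q≤p {p} {q} q≥0 = subst (p ℚ.- q ℚ.≤_) (ℚ.+-identityʳ p) (ℚ.+-monoʳ-≤ p (ℚ.neg-antimono-≤ q≥0))

p≤q+r⇒p-q≤r : ∀ {p q r} → p ℚ.≤ q ℚ.+ r → p ℚ.- q ℚ.≤ r
p≤q+r⇒p-q≤r {p} {q} {r} p≤q+r = subst (p ℚ.- q ℚ.≤_) (cancel q r) (ℚ.+-monoˡ-≤ (ℚ.- q) p≤q+r)
  where
  cancel : ∀ q r → q ℚ.+ r ℚ.- q ≡ r
  cancel = solve 2 (λ q r → q :+ r :- q := r) refl

*-pos : ∀ {p q} → 0ℚ ℚ.< p → 0ℚ ℚ.< q → 0ℚ ℚ.< p ℚ.* q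
*-pos {p} {q} p>0 q>0 =
  ℚ.positive⁻¹ (p ℚ.* q) {{ℚ.pos*pos⇒pos p {{ℚ.positive p>0}} q {{ℚ.positive q>0}}}}

*-nonNeg : ∀ {p q} → 0ℚ ℚ.≤ p → 0ℚ ℚ.≤ q → 0ℚ ℚ.≤ p ℚ.* q
*-nonNeg {p} {q} p≥0 q≥0 =
  ℚ.nonNegative⁻¹ (p ℚ.* q) {{ℚ.nonNeg*nonNeg⇒nonNeg p {{ℚ.nonNegative p≥0}} q {{ℚ.nonNegative q≥0}}}}

average≡⇒≤ : ∀ {p q a b m} → 0ℚ ℚ.< p → p ℚ.+ q ≡ 1ℚ → 0ℚ ℚ.≤ q → m ℚ.≤ b →
             p ℚ.* a ℚ.+ q ℚ.* b ≡ m → a ℚ.≤ m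
average≡⇒≤ {p} {q} {a} {b} {m} p>0 p+q≡1 q≥0 m≤b average =
  ℚ.*-cancelˡ-≤-pos p {{ℚ.positive p>0}} (begin
    p ℚ.* a                                ≡⟨ add-sub (p ℚ.* a) (q ℚ.* b) ⟩
    p ℚ.* a ℚ.+ q ℚ.* b ℚ.- q ℚ.* b        ≡⟨ cong (ℚ._- q ℚ.* b) average ⟩
    m ℚ.- q ℚ.* b                          ≤⟨ ℚ.+-monoʳ-≤ m (ℚ.neg-antimono-≤
                                                (ℚ.*-monoˡ-≤-nonNeg q {{ℚ.nonNegative q≥0}} m≤b)) ⟩
    m ℚ.- q ℚ.* m                          ≡⟨ cong (ℚ._- q ℚ.* m) (ℚ.*-identityˡ m) ⟨
    1ℚ ℚ.* m ℚ.- q ℚ.* m                   ≡⟨ cong (λ s → s ℚ.* m ℚ.- q ℚ.* m) p+q≡1 ⟨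
    (p ℚ.+ q) ℚ.* m ℚ.- q ℚ.* m            ≡⟨ distrib-sub p q m ⟩
    p ℚ.* m                                ∎)
  where
  open ℚ.≤-Reasoning
  add-sub : ∀ x y → x ≡ x ℚ.+ y ℚ.- y
  add-sub = solve 2 (λ x y → x := x :+ y :- y) refl
  distrib-sub : ∀ p q m → (p ℚ.+ q) ℚ.* m ℚ.- q ℚ.* m ≡ p ℚ.* m
  distrib-sub = solve 3 (λ p q m → (p :+ q) :* m :- q :* m := p :* m) refl

convex-tight : ∀ {t a b m} → 0ℚ ℚ.< t → t ℚ.< 1ℚ → m ℚ.≤ a → m ℚ.≤ b →
               t ℚ.* a ℚ.+ (1ℚ ℚ.- t) ℚ.* b ≡ m → a ≡ m × b ≡ m
convex-tight {t} {a} {b} t>0 t<1 m≤a m≤b average =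
  ℚ.≤-antisym (average≡⇒≤ t>0 weights (ℚ.<⇒≤ (0<q-p t<1)) m≤b average) m≤a ,
  ℚ.≤-antisym (average≡⇒≤ (0<q-p t<1) (trans (ℚ.+-comm (1ℚ ℚ.- t) t) weights) (ℚ.<⇒≤ t>0) m≤a
                 (trans (ℚ.+-comm ((1ℚ ℚ.- t) ℚ.* b) (t ℚ.* a)) average)) m≤b
  where
  complement : ∀ t → t ℚ.+ (1ℚ ℚ.- t) ≡ 1ℚ
  complement = solve 1 (λ t → t :+ (con 1ℚ :- t) := con 1ℚ) refl
  weights : t ℚ.+ (1ℚ ℚ.- t) ≡ 1ℚ
  weights = complement t

-- Extreme points of upward closed sets

UpwardClosed : ((Fin n → ℚ) → Set) → Set
UpwardClosed {n} P = ∀ {ρ σ : Fin n → ℚ} → P ρ → (∀ e → ρ e ℚ.≤ σ e) → P σ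

-- ρ is the midpoint of σ and of its reflection ρ + (ρ − σ), which lies in P as it dominates ρ.
extreme-minimal : {P : (Fin n → ℚ) → Set} {ρ σ : Fin n → ℚ} →
                  UpwardClosed P → IsExtremePoint P ρ → P σ → (∀ e → σ e ℚ.≤ ρ e) →
                  ∀ e → σ e ≡ ρ e
extreme-minimal {ρ = ρ} {σ} upward (Pρ , extreme) Pσ σ≤ρ e = begin
  σ e                                       ≡⟨ midpoint-self (σ e) ⟨
  ½ ℚ.* σ e ℚ.+ (1ℚ ℚ.- ½) ℚ.* σ e          ≡⟨ cong (λ x → ½ ℚ.* σ e ℚ.+ (1ℚ ℚ.- ½) ℚ.* x) σ≡reflection ⟩
  ½ ℚ.* σ e ℚ.+ (1ℚ ℚ.- ½) ℚ.* reflection e ≡⟨ reflection-midpoint (σ e) (ρ e) ⟩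
  ρ e                                       ∎
  where
  open ≡-Reasoning
  midpoint-self : ∀ x → ½ ℚ.* x ℚ.+ (1ℚ ℚ.- ½) ℚ.* x ≡ x
  midpoint-self = solve 1 (λ x → con ½ :* x :+ (con 1ℚ :- con ½) :* x := x) refl
  reflection-midpoint : ∀ x y → ½ ℚ.* x ℚ.+ (1ℚ ℚ.- ½) ℚ.* (y ℚ.+ (y ℚ.- x)) ≡ y
  reflection-midpoint = solve 2 (λ x y → con ½ :* x :+ (con 1ℚ :- con ½) :* (y :+ (y :- x)) := y) refl
  reflection : Fin _ → ℚ
  reflection e = ρ e ℚ.+ (ρ e ℚ.- σ e)
  σ≡reflection : σ e ≡ reflection e
  σ≡reflection = extreme σ reflection ½ Pσ (upward Pρ (λ e → p≤p+q (0≤q-p (σ≤ρ e))))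
                   (ℚ.positive⁻¹ ½) (from-yes (½ ℚ.<? 1ℚ))
                   (λ e → sym (reflection-midpoint (σ e) (ρ e))) e

-- Subsets and sums over subsets

Disjoint : Subset n → Subset n → Set
Disjoint p q = ∀ {x} → x ∈ p → x ∉ q

⊆-or-witness : (p q : Subset n) → p ⊆ q ⊎ ∃[ x ] (x ∈ p × x ∉ q)
⊆-or-witness p q with any? (λ x → x ∈? p ×-dec ¬? (x ∈? q))
... | yes witness = inj₂ witness
... | no  ¬witness = inj₁ λ {x} x∈p → decidable-stable (x ∈? q) (λ x∉q → ¬witness (x , x∈p , x∉q))

satisfying : {P : Pred (Fin n) ℓ} → Decidable P → Subset n
satisfying P? = tabulate (λ x → ⌊ P? x ⌋)

∈-satisfying⁺ : {P : Pred (Fin n) ℓ} (P? : Decidable P) {x : Fin n} → P x → x ∈ satisfying P?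
∈-satisfying⁺ P? {x} px =
  lookup⇒[]= x _ (trans (lookup∘tabulate _ x) (trans (isYes≗does (P? x)) (dec-true (P? x) px)))

∈-satisfying⁻ : {P : Pred (Fin n) ℓ} (P? : Decidable P) {x : Fin n} → x ∈ satisfying P? → P x
∈-satisfying⁻ P? {x} x∈ with P? x | trans (sym (lookup∘tabulate (λ y → ⌊ P? y ⌋) x)) ([]=⇒lookup x∈)
... | yes px | _ = px

∪-lub : {p q r : Subset n} → p ⊆ r → q ⊆ r → p ∪ q ⊆ r
∪-lub {p = p} {q} p⊆r q⊆r x∈p∪q with x∈p∪q⁻ p q x∈p∪q
... | inj₁ x∈p = p⊆r x∈p
... | inj₂ x∈q = q⊆r x∈q

∪-mono : {p p′ q q′ : Subset n} → p ⊆ p′ → q ⊆ q′ → p ∪ q ⊆ p′ ∪ q′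
∪-mono {p′ = p′} {q′ = q′} p⊆p′ q⊆q′ = ∪-lub (⊆-trans p⊆p′ (p⊆p∪q q′)) (⊆-trans q⊆q′ (q⊆p∪q p′ q′))

⊆∪⇒⊆ˡ : {p q r : Subset n} → p ⊆ q ∪ r → Disjoint p r → p ⊆ q
⊆∪⇒⊆ˡ {q = q} {r} p⊆q∪r disjoint {x} x∈p with x∈p∪q⁻ q r (p⊆q∪r x∈p)
... | inj₁ x∈q = x∈q
... | inj₂ x∈r = contradiction x∈r (disjoint x∈p)

⊆∪⇒⊆ʳ : {p q r : Subset n} → p ⊆ q ∪ r → Disjoint p q → p ⊆ r
⊆∪⇒⊆ʳ {q = q} {r} p⊆q∪r disjoint {x} x∈p with x∈p∪q⁻ q r (p⊆q∪r x∈p)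
... | inj₁ x∈q = contradiction x∈q (disjoint x∈p)
... | inj₂ x∈r = x∈r

x∈p⇒⁅x⁆⊆p : {p : Subset n} {x : Fin n} → x ∈ p → ⁅ x ⁆ ⊆ p
x∈p⇒⁅x⁆⊆p {p = p} {x} x∈p y∈⁅x⁆ = subst (_∈ p) (sym (x∈⁅y⁆⇒x≡y x y∈⁅x⁆)) x∈p

x∉p⇒Disjoint-⁅x⁆ : {p : Subset n} {x : Fin n} → x ∉ p → Disjoint p ⁅ x ⁆
x∉p⇒Disjoint-⁅x⁆ {p = p} {x} x∉p y∈p y∈⁅x⁆ = x∉p (subst (_∈ p) (x∈⁅y⁆⇒x≡y x y∈⁅x⁆) y∈p)

x∈q⇒x∉p─q : {p q : Subset n} {x : Fin n} → x ∈ q → x ∉ p ─ q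
x∈q⇒x∉p─q {p = _ ∷ _} here ()
x∈q⇒x∉p─q {p = _ ∷ _} {_ ∷ _} (there x∈q) (there x∈p─q) = x∈q⇒x∉p─q x∈q x∈p─q

x∉p-x : (p : Subset n) (x : Fin n) → x ∉ p - x
x∉p-x p x = x∈q⇒x∉p─q (x∈⁅x⁆ x)

x∈p-y⇒x≢y : {p : Subset n} {x y : Fin n} → x ∈ p - y → x ≢ y
x∈p-y⇒x≢y {p = p} {y = y} x∈p-y refl = x∉p-x p y x∈p-y

p⊆q∧x∉p⇒p⊆q-x : {p q : Subset n} {x : Fin n} → p ⊆ q → x ∉ p → p ⊆ q - x
p⊆q∧x∉p⇒p⊆q-x p⊆q x∉p y∈p = x∈p∧x≢y⇒x∈p-y (p⊆q y∈p) (λ { refl → x∉p y∈p })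

p⊆∁q∪[p∩q] : (p q : Subset n) → p ⊆ ∁ q ∪ (p ∩ q)
p⊆∁q∪[p∩q] p q {x} x∈p with x ∈? q
... | yes x∈q = q⊆p∪q (∁ q) (p ∩ q) (x∈p∩q⁺ (x∈p , x∈q))
... | no  x∉q = p⊆p∪q (p ∩ q) (x∉p⇒x∈∁p x∉q)

p⊆q∪[p∩∁q] : (p q : Subset n) → p ⊆ q ∪ (p ∩ ∁ q)
p⊆q∪[p∩∁q] p q {x} x∈p with x ∈? q
... | yes x∈q = p⊆p∪q (p ∩ ∁ q) x∈q
... | no  x∉q = q⊆p∪q q (p ∩ ∁ q) (x∈p∩q⁺ (x∈p , x∉p⇒x∈∁p x∉q))

∁q⊆[p∩∁q]∪∁p : (p q : Subset n) → ∁ q ⊆ (p ∩ ∁ q) ∪ ∁ p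
∁q⊆[p∩∁q]∪∁p p q {x} x∈∁q with x ∈? p
... | yes x∈p = p⊆p∪q (∁ p) (x∈p∩q⁺ (x∈p , x∈∁q))
... | no  x∉p = q⊆p∪q (p ∩ ∁ q) (∁ p) (x∉p⇒x∈∁p x∉p)

∁[p∩∁q]⊆q∪∁p : (p q : Subset n) → ∁ (p ∩ ∁ q) ⊆ q ∪ ∁ p
∁[p∩∁q]⊆q∪∁p p q {x} x∈∁[p∩∁q] with x ∈? p | x ∈? q
... | _       | yes x∈q = p⊆p∪q (∁ p) x∈q
... | yes x∈p | no  x∉q = contradiction (x∈p∩q⁺ (x∈p , x∉p⇒x∈∁p x∉q)) (x∈∁p⇒x∉p x∈∁[p∩∁q])
... | no  x∉p | no  _   = q⊆p∪q q (∁ p) (x∉p⇒x∈∁p x∉p)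

∁[p-x]⊆∁p∪⁅x⁆ : (p : Subset n) (x : Fin n) → ∁ (p - x) ⊆ ∁ p ∪ ⁅ x ⁆
∁[p-x]⊆∁p∪⁅x⁆ p x {y} y∈∁[p-x] with y Fin.≟ x
... | yes refl = q⊆p∪q (∁ p) ⁅ x ⁆ (x∈⁅x⁆ x)
... | no  y≢x  = p⊆p∪q ⁅ x ⁆ (x∉p⇒x∈∁p λ y∈p → x∈∁p⇒x∉p y∈∁[p-x] (x∈p∧x≢y⇒x∈p-y y∈p y≢x))

p-x∪⁅x⁆≡p : {p : Subset n} {x : Fin n} → x ∈ p → (p - x) ∪ ⁅ x ⁆ ≡ p
p-x∪⁅x⁆≡p {p = p} {x} x∈p = ⊆-antisym (∪-lub (p─q⊆p p ⁅ x ⁆) (x∈p⇒⁅x⁆⊆p x∈p)) p⊆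
  where
  p⊆ : p ⊆ (p - x) ∪ ⁅ x ⁆
  p⊆ {y} y∈p with y Fin.≟ x
  ... | yes refl = q⊆p∪q (p - x) ⁅ x ⁆ (x∈⁅x⁆ x)
  ... | no  y≢x  = p⊆p∪q ⁅ x ⁆ (x∈p∧x≢y⇒x∈p-y y∈p y≢x)

∣∪∣-disjoint : {p q : Subset n} → Disjoint p q → ∣ p ∪ q ∣ ≡ ∣ p ∣ ℕ.+ ∣ q ∣
∣∪∣-disjoint {p = []}          {[]}          _        = refl
∣∪∣-disjoint {p = inside ∷ p}  {inside ∷ q}  disjoint = contradiction here (disjoint here)
∣∪∣-disjoint {p = inside ∷ p}  {outside ∷ q} disjoint =
  cong suc (∣∪∣-disjoint (λ x∈p x∈q → disjoint (there x∈p) (there x∈q)))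
∣∪∣-disjoint {p = outside ∷ p} {inside ∷ q}  disjoint =
  trans (cong suc (∣∪∣-disjoint (λ x∈p x∈q → disjoint (there x∈p) (there x∈q)))) (sym (ℕ.+-suc ∣ p ∣ ∣ q ∣))
∣∪∣-disjoint {p = outside ∷ p} {outside ∷ q} disjoint =
  ∣∪∣-disjoint (λ x∈p x∈q → disjoint (there x∈p) (there x∈q))

∣p∪⁅x⁆∣ : {p : Subset n} {x : Fin n} → x ∉ p → ∣ p ∪ ⁅ x ⁆ ∣ ≡ suc ∣ p ∣
∣p∪⁅x⁆∣ {p = p} {x} x∉p = begin
  ∣ p ∪ ⁅ x ⁆ ∣         ≡⟨ ∣∪∣-disjoint (x∉p⇒Disjoint-⁅x⁆ x∉p) ⟩
  ∣ p ∣ ℕ.+ ∣ ⁅ x ⁆ ∣   ≡⟨ cong (∣ p ∣ ℕ.+_) (∣⁅x⁆∣≡1 x) ⟩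
  ∣ p ∣ ℕ.+ 1           ≡⟨ ℕ.+-comm ∣ p ∣ 1 ⟩
  suc ∣ p ∣             ∎
  where open ≡-Reasoning

∣p-x∣ : {p : Subset n} {x : Fin n} → x ∈ p → suc ∣ p - x ∣ ≡ ∣ p ∣
∣p-x∣ {p = p} {x} x∈p = trans (sym (∣p∪⁅x⁆∣ (x∉p-x p x))) (cong ∣_∣ (p-x∪⁅x⁆≡p x∈p))

minimum-on : (f : Fin n → ℚ) {X : Subset n} → Nonempty X → ∃[ m ] (m ∈ X × ∀ {x} → x ∈ X → f m ℚ.≤ f x)
minimum-on {n} f {X} (x₀ , x₀∈X) =
  argmin f x₀ members ,
  argmin-all f {P = _∈ X} x₀∈X (all-filter (_∈? X) (allFin n)) ,
  λ x∈X → All.lookup (f[argmin]≤f[xs] x₀ members) (∈-filter⁺ (_∈? X) (∈-allFin _) x∈X)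
  where
  members : List (Fin n)
  members = filter (_∈? X) (allFin n)

sumOver-cong : (B : Subset n) {f g : Fin n → ℚ} → (∀ {i} → i ∈ B → f i ≡ g i) →
               sumOver B f ≡ sumOver B g
sumOver-cong []            f≗g = refl
sumOver-cong (inside ∷ B)  f≗g = cong₂ ℚ._+_ (f≗g here) (sumOver-cong B (f≗g ∘ there))
sumOver-cong (outside ∷ B) f≗g = cong (0ℚ ℚ.+_) (sumOver-cong B (f≗g ∘ there))

sumOver-+ : (B : Subset n) (f g : Fin n → ℚ) →
            sumOver B (λ i → f i ℚ.+ g i) ≡ sumOver B f ℚ.+ sumOver B g
sumOver-+ []            f g = refl
sumOver-+ (inside ∷ B)  f g =
  trans (cong (f Fin.zero ℚ.+ g Fin.zero ℚ.+_) (sumOver-+ B (f ∘ Fin.suc) (g ∘ Fin.suc)))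
        (interchange (f Fin.zero) (g Fin.zero) (sumOver B (f ∘ Fin.suc)) (sumOver B (g ∘ Fin.suc)))
  where
  interchange : ∀ a b c d → a ℚ.+ b ℚ.+ (c ℚ.+ d) ≡ a ℚ.+ c ℚ.+ (b ℚ.+ d)
  interchange = solve 4 (λ a b c d → a :+ b :+ (c :+ d) := a :+ c :+ (b :+ d)) refl
sumOver-+ (outside ∷ B) f g = trans (cong (0ℚ ℚ.+_) (sumOver-+ B (f ∘ Fin.suc) (g ∘ Fin.suc)))
                                    (zeros (sumOver B (f ∘ Fin.suc)) (sumOver B (g ∘ Fin.suc)))
  where
  zeros : ∀ c d → 0ℚ ℚ.+ (c ℚ.+ d) ≡ 0ℚ ℚ.+ c ℚ.+ (0ℚ ℚ.+ d)
  zeros = solve 2 (λ c d → con 0ℚ :+ (c :+ d) := con 0ℚ :+ c :+ (con 0ℚ :+ d)) refl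

sumOver-*ˡ : (B : Subset n) (c : ℚ) (f : Fin n → ℚ) →
             sumOver B (λ i → c ℚ.* f i) ≡ c ℚ.* sumOver B f
sumOver-*ˡ []            c f = sym (ℚ.*-zeroʳ c)
sumOver-*ˡ (inside ∷ B)  c f = trans (cong (c ℚ.* f Fin.zero ℚ.+_) (sumOver-*ˡ B c (f ∘ Fin.suc)))
                                     (sym (ℚ.*-distribˡ-+ c (f Fin.zero) (sumOver B (f ∘ Fin.suc))))
sumOver-*ˡ (outside ∷ B) c f =
  trans (cong (0ℚ ℚ.+_) (sumOver-*ˡ B c (f ∘ Fin.suc))) (zeros c (sumOver B (f ∘ Fin.suc)))
  where
  zeros : ∀ c s → 0ℚ ℚ.+ c ℚ.* s ≡ c ℚ.* (0ℚ ℚ.+ s)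
  zeros = solve 2 (λ c s → con 0ℚ :+ c :* s := c :* (con 0ℚ :+ s)) refl

sumOver-mono : (B : Subset n) {f g : Fin n → ℚ} → (∀ i → f i ℚ.≤ g i) →
               sumOver B f ℚ.≤ sumOver B g
sumOver-mono []            f≤g = ℚ.≤-refl
sumOver-mono (inside ∷ B)  f≤g = ℚ.+-mono-≤ (f≤g Fin.zero) (sumOver-mono B (f≤g ∘ Fin.suc))
sumOver-mono (outside ∷ B) f≤g = ℚ.+-monoʳ-≤ 0ℚ (sumOver-mono B (f≤g ∘ Fin.suc))

sumOver-⊆-mono : {A B : Subset n} (f : Fin n → ℚ) → (∀ i → 0ℚ ℚ.≤ f i) → A ⊆ B →
                 sumOver A f ℚ.≤ sumOver B f
sumOver-⊆-mono {A = []}          {[]}          f f≥0 A⊆B = ℚ.≤-refl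
sumOver-⊆-mono {A = inside ∷ A}  {inside ∷ B}  f f≥0 A⊆B =
  ℚ.+-monoʳ-≤ (f Fin.zero) (sumOver-⊆-mono (f ∘ Fin.suc) (f≥0 ∘ Fin.suc) (drop-∷-⊆ A⊆B))
sumOver-⊆-mono {A = inside ∷ A}  {outside ∷ B} f f≥0 A⊆B with () ← A⊆B here
sumOver-⊆-mono {A = outside ∷ A} {inside ∷ B}  f f≥0 A⊆B =
  ℚ.+-mono-≤ (f≥0 Fin.zero) (sumOver-⊆-mono (f ∘ Fin.suc) (f≥0 ∘ Fin.suc) (drop-∷-⊆ A⊆B))
sumOver-⊆-mono {A = outside ∷ A} {outside ∷ B} f f≥0 A⊆B =
  ℚ.+-monoʳ-≤ 0ℚ (sumOver-⊆-mono (f ∘ Fin.suc) (f≥0 ∘ Fin.suc) (drop-∷-⊆ A⊆B))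

sumOver-∪ : {A B : Subset n} (f : Fin n → ℚ) → Disjoint A B →
            sumOver (A ∪ B) f ≡ sumOver A f ℚ.+ sumOver B f
sumOver-∪ {A = []}          {[]}          f disjoint = refl
sumOver-∪ {A = inside ∷ A}  {inside ∷ B}  f disjoint = contradiction here (disjoint here)
sumOver-∪ {A = inside ∷ A}  {outside ∷ B} f disjoint =
  trans (cong (f Fin.zero ℚ.+_) (sumOver-∪ (f ∘ Fin.suc) (λ x∈A x∈B → disjoint (there x∈A) (there x∈B))))
        (left (f Fin.zero) (sumOver A (f ∘ Fin.suc)) (sumOver B (f ∘ Fin.suc)))
  where
  left : ∀ a s t → a ℚ.+ (s ℚ.+ t) ≡ a ℚ.+ s ℚ.+ (0ℚ ℚ.+ t)
  left = solve 3 (λ a s t → a :+ (s :+ t) := a :+ s :+ (con 0ℚ :+ t)) refl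
sumOver-∪ {A = outside ∷ A} {inside ∷ B}  f disjoint =
  trans (cong (f Fin.zero ℚ.+_) (sumOver-∪ (f ∘ Fin.suc) (λ x∈A x∈B → disjoint (there x∈A) (there x∈B))))
        (right (f Fin.zero) (sumOver A (f ∘ Fin.suc)) (sumOver B (f ∘ Fin.suc)))
  where
  right : ∀ b s t → b ℚ.+ (s ℚ.+ t) ≡ 0ℚ ℚ.+ s ℚ.+ (b ℚ.+ t)
  right = solve 3 (λ b s t → b :+ (s :+ t) := con 0ℚ :+ s :+ (b :+ t)) refl
sumOver-∪ {A = outside ∷ A} {outside ∷ B} f disjoint =
  trans (cong (0ℚ ℚ.+_) (sumOver-∪ (f ∘ Fin.suc) (λ x∈A x∈B → disjoint (there x∈A) (there x∈B))))
        (neither (sumOver A (f ∘ Fin.suc)) (sumOver B (f ∘ Fin.suc)))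
  where
  neither : ∀ s t → 0ℚ ℚ.+ (s ℚ.+ t) ≡ 0ℚ ℚ.+ s ℚ.+ (0ℚ ℚ.+ t)
  neither = solve 2 (λ s t → con 0ℚ :+ (s :+ t) := con 0ℚ :+ s :+ (con 0ℚ :+ t)) refl

sumOver-const : (B : Subset n) {f : Fin n → ℚ} (c : ℚ) → (∀ {i} → i ∈ B → f i ≡ c) →
                sumOver B f ≡ c ℚ.* fromℕ ∣ B ∣
sumOver-const []            c f≡c = sym (ℚ.*-zeroʳ c)
sumOver-const (inside ∷ B) {f} c f≡c = begin
  f Fin.zero ℚ.+ sumOver B (f ∘ Fin.suc) ≡⟨ cong₂ ℚ._+_ (f≡c here) (sumOver-const B c (f≡c ∘ there)) ⟩
  c ℚ.+ c ℚ.* fromℕ ∣ B ∣        ≡⟨ step c (fromℕ ∣ B ∣) ⟩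
  c ℚ.* (1ℚ ℚ.+ fromℕ ∣ B ∣)     ≡⟨ cong (c ℚ.*_) (fromℕ-suc ∣ B ∣) ⟨
  c ℚ.* fromℕ (suc ∣ B ∣)        ∎
  where
  open ≡-Reasoning
  step : ∀ c m → c ℚ.+ c ℚ.* m ≡ c ℚ.* (1ℚ ℚ.+ m)
  step = solve 2 (λ c m → c :+ c :* m := c :* (con 1ℚ :+ m)) refl
sumOver-const (outside ∷ B) {f} c f≡c =
  trans (ℚ.+-identityˡ (sumOver B (f ∘ Fin.suc))) (sumOver-const B c (f≡c ∘ there))

sumOver-zero : (B : Subset n) {f : Fin n → ℚ} → (∀ {i} → i ∈ B → f i ≡ 0ℚ) → sumOver B f ≡ 0ℚ
sumOver-zero B f≡0 = trans (sumOver-const B 0ℚ f≡0) (ℚ.*-zeroˡ (fromℕ ∣ B ∣))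

sumOver-⁅⁆ : (x : Fin n) (f : Fin n → ℚ) → sumOver ⁅ x ⁆ f ≡ f x
sumOver-⁅⁆ Fin.zero    f =
  trans (cong (f Fin.zero ℚ.+_) (sumOver-zero ⊥ {f ∘ Fin.suc} (λ i∈⊥ → contradiction i∈⊥ ∉⊥)))
        (ℚ.+-identityʳ (f Fin.zero))
sumOver-⁅⁆ (Fin.suc x) f = trans (ℚ.+-identityˡ (sumOver ⁅ x ⁆ (f ∘ Fin.suc))) (sumOver-⁅⁆ x (f ∘ Fin.suc))

sumOver-indicator : (B X : Subset n) (c : ℚ) → sumOver B (scaledIndicator c X) ≡ c ℚ.* fromℕ ∣ B ∩ X ∣
sumOver-indicator []            []            c = sym (ℚ.*-zeroʳ c)
sumOver-indicator (inside ∷ B)  (inside ∷ X)  c = begin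
  c ℚ.+ sumOver B (scaledIndicator c X)   ≡⟨ cong (c ℚ.+_) (sumOver-indicator B X c) ⟩
  c ℚ.+ c ℚ.* fromℕ ∣ B ∩ X ∣             ≡⟨ step c (fromℕ ∣ B ∩ X ∣) ⟩
  c ℚ.* (1ℚ ℚ.+ fromℕ ∣ B ∩ X ∣)          ≡⟨ cong (c ℚ.*_) (fromℕ-suc ∣ B ∩ X ∣) ⟨
  c ℚ.* fromℕ (suc ∣ B ∩ X ∣)             ∎
  where
  open ≡-Reasoning
  step : ∀ c m → c ℚ.+ c ℚ.* m ≡ c ℚ.* (1ℚ ℚ.+ m)
  step = solve 2 (λ c m → c :+ c :* m := c :* (con 1ℚ :+ m)) refl
sumOver-indicator (inside ∷ B)  (outside ∷ X) c =
  trans (ℚ.+-identityˡ (sumOver B (scaledIndicator c X))) (sumOver-indicator B X c)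
sumOver-indicator (outside ∷ B) (_ ∷ X)       c =
  trans (ℚ.+-identityˡ (sumOver B (scaledIndicator c X))) (sumOver-indicator B X c)

sumOver-∪⁅⁆ : {A : Subset n} {x : Fin n} (f : Fin n → ℚ) → x ∉ A →
              sumOver (A ∪ ⁅ x ⁆) f ≡ sumOver A f ℚ.+ f x
sumOver-∪⁅⁆ {A = A} {x} f x∉A =
  trans (sumOver-∪ f (x∉p⇒Disjoint-⁅x⁆ x∉A)) (cong (sumOver A f ℚ.+_) (sumOver-⁅⁆ x f))

sumOver-linear : (B : Subset n) (a b : ℚ) (f g : Fin n → ℚ) →
                 sumOver B (λ i → a ℚ.* f i ℚ.+ b ℚ.* g i) ≡ a ℚ.* sumOver B f ℚ.+ b ℚ.* sumOver B g
sumOver-linear B a b f g =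
  trans (sumOver-+ B (λ i → a ℚ.* f i) (λ i → b ℚ.* g i)) (cong₂ ℚ._+_ (sumOver-*ˡ B a f) (sumOver-*ˡ B b g))

scaledIndicator-∈ : {X : Subset n} {x : Fin n} (c : ℚ) → x ∈ X → scaledIndicator c X x ≡ c
scaledIndicator-∈ c x∈X rewrite []=⇒lookup x∈X = refl

scaledIndicator-∉ : {X : Subset n} {x : Fin n} (c : ℚ) → x ∉ X → scaledIndicator c X x ≡ 0ℚ
scaledIndicator-∉ {X = X} {x} c x∉X with lookup X x in x∈?X
... | true  = contradiction (lookup⇒[]= x X x∈?X) x∉X
... | false = refl

scaledIndicator-nonNeg : {X : Subset n} {c : ℚ} → 0ℚ ℚ.≤ c → ∀ x → 0ℚ ℚ.≤ scaledIndicator c X x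
scaledIndicator-nonNeg {X = X} c≥0 x with lookup X x
... | true  = c≥0
... | false = ℚ.≤-refl

scaledIndicator-mono : {X Y : Subset n} {c : ℚ} → 0ℚ ℚ.≤ c → Y ⊆ X →
                       ∀ x → scaledIndicator c Y x ℚ.≤ scaledIndicator c X x
scaledIndicator-mono {X = X} {Y} {c} c≥0 Y⊆X x with x ∈? Y
... | yes x∈Y = ℚ.≤-reflexive (trans (scaledIndicator-∈ c x∈Y) (sym (scaledIndicator-∈ c (Y⊆X x∈Y))))
... | no  x∉Y = subst (ℚ._≤ scaledIndicator c X x) (sym (scaledIndicator-∉ c x∉Y))
                      (scaledIndicator-nonNeg {X = X} c≥0 x)

scaledIndicator-split : {X Z : Subset n} {c c₁ c₂ t : ℚ} → Z ⊆ X →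
                        t ℚ.* c₁ ≡ c → (1ℚ ℚ.- t) ℚ.* c₂ ≡ c → ∀ x →
                        scaledIndicator c X x ≡
                        t ℚ.* scaledIndicator c₁ Z x ℚ.+ (1ℚ ℚ.- t) ℚ.* scaledIndicator c₂ (X ∩ ∁ Z) x
scaledIndicator-split {X = X} {Z} {c} {c₁} {c₂} {t} Z⊆X tc₁≡c sc₂≡c x with x ∈? Z | x ∈? X
... | yes x∈Z | _ = begin
  scaledIndicator c X x                ≡⟨ scaledIndicator-∈ c (Z⊆X x∈Z) ⟩
  c                                    ≡⟨ tc₁≡c ⟨
  t ℚ.* c₁                             ≡⟨ pad-right (t ℚ.* c₁) (1ℚ ℚ.- t) ⟩
  t ℚ.* c₁ ℚ.+ (1ℚ ℚ.- t) ℚ.* 0ℚ       ≡⟨ cong₂ (λ a b → t ℚ.* a ℚ.+ (1ℚ ℚ.- t) ℚ.* b)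
                                            (scaledIndicator-∈ c₁ x∈Z) (scaledIndicator-∉ c₂ x∉X∩∁Z) ⟨
  t ℚ.* scaledIndicator c₁ Z x ℚ.+ (1ℚ ℚ.- t) ℚ.* scaledIndicator c₂ (X ∩ ∁ Z) x ∎
  where
  open ≡-Reasoning
  x∉X∩∁Z : x ∉ X ∩ ∁ Z
  x∉X∩∁Z x∈X∩∁Z = x∈∁p⇒x∉p (proj₂ (x∈p∩q⁻ X (∁ Z) x∈X∩∁Z)) x∈Z
  pad-right : ∀ a s → a ≡ a ℚ.+ s ℚ.* 0ℚ
  pad-right = solve 2 (λ a s → a := a :+ s :* con 0ℚ) refl
... | no x∉Z | yes x∈X = begin
  scaledIndicator c X x                ≡⟨ scaledIndicator-∈ c x∈X ⟩
  c                                    ≡⟨ sc₂≡c ⟨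
  (1ℚ ℚ.- t) ℚ.* c₂                    ≡⟨ pad-left t ((1ℚ ℚ.- t) ℚ.* c₂) ⟩
  t ℚ.* 0ℚ ℚ.+ (1ℚ ℚ.- t) ℚ.* c₂       ≡⟨ cong₂ (λ a b → t ℚ.* a ℚ.+ (1ℚ ℚ.- t) ℚ.* b)
                                            (scaledIndicator-∉ c₁ x∉Z)
                                            (scaledIndicator-∈ c₂ (x∈p∩q⁺ (x∈X , x∉p⇒x∈∁p x∉Z))) ⟨
  t ℚ.* scaledIndicator c₁ Z x ℚ.+ (1ℚ ℚ.- t) ℚ.* scaledIndicator c₂ (X ∩ ∁ Z) x ∎
  where
  open ≡-Reasoning
  pad-left : ∀ t b → b ≡ t ℚ.* 0ℚ ℚ.+ b
  pad-left = solve 2 (λ t b → b := t :* con 0ℚ :+ b) refl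
... | no x∉Z | no x∉X = begin
  scaledIndicator c X x                ≡⟨ scaledIndicator-∉ c x∉X ⟩
  0ℚ                                   ≡⟨ zeros t (1ℚ ℚ.- t) ⟩
  t ℚ.* 0ℚ ℚ.+ (1ℚ ℚ.- t) ℚ.* 0ℚ       ≡⟨ cong₂ (λ a b → t ℚ.* a ℚ.+ (1ℚ ℚ.- t) ℚ.* b)
                                            (scaledIndicator-∉ c₁ x∉Z)
                                            (scaledIndicator-∉ c₂ (x∉X ∘ proj₁ ∘ x∈p∩q⁻ X (∁ Z))) ⟨
  t ℚ.* scaledIndicator c₁ Z x ℚ.+ (1ℚ ℚ.- t) ℚ.* scaledIndicator c₂ (X ∩ ∁ Z) x ∎
  where
  open ≡-Reasoning
  zeros : ∀ t s → 0ℚ ≡ t ℚ.* 0ℚ ℚ.+ s ℚ.* 0ℚ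
  zeros = solve 2 (λ t s → con 0ℚ := t :* con 0ℚ :+ s :* con 0ℚ) refl

scaledIndicator-*ˡ : (a c : ℚ) (X : Subset n) (x : Fin n) →
                     scaledIndicator (a ℚ.* c) X x ≡ a ℚ.* scaledIndicator c X x
scaledIndicator-*ˡ a c X x with lookup X x
... | true  = refl
... | false = sym (ℚ.*-zeroʳ a)

-- Matroids

module MatroidTheory {n : ℕ} (M : Matroid n) where
  open Matroid M

  r-⊥ : r ⊥ ≡ 0
  r-⊥ = ℕ.n≤0⇒n≡0 (subst (r ⊥ ℕ.≤_) (∣⊥∣≡0 n) (r-bounded ⊥))

  r-submod-⊆ : ∀ {P Q A B} → P ⊆ A ∪ B → Q ⊆ A ∩ B → r P ℕ.+ r Q ℕ.≤ r A ℕ.+ r B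
  r-submod-⊆ {P} {Q} {A} {B} P⊆A∪B Q⊆A∩B =
    ℕ.≤-trans (ℕ.+-mono-≤ (r-mono P (A ∪ B) P⊆A∪B) (r-mono Q (A ∩ B) Q⊆A∩B)) (r-submod A B)

  r-∪-≤ : ∀ A B → r (A ∪ B) ℕ.≤ r A ℕ.+ ∣ B ∣
  r-∪-≤ A B = begin
    r (A ∪ B)                   ≤⟨ ℕ.m≤m+n _ _ ⟩
    r (A ∪ B) ℕ.+ r (A ∩ B)     ≤⟨ r-submod A B ⟩
    r A ℕ.+ r B                 ≤⟨ ℕ.+-monoʳ-≤ (r A) (r-bounded B) ⟩
    r A ℕ.+ ∣ B ∣               ∎
    where open ℕ.≤-Reasoning

  r-∪⁅⁆-≤ : ∀ A x → r (A ∪ ⁅ x ⁆) ℕ.≤ suc (r A)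
  r-∪⁅⁆-≤ A x = subst (r (A ∪ ⁅ x ⁆) ℕ.≤_) (trans (cong (r A ℕ.+_) (∣⁅x⁆∣≡1 x)) (ℕ.+-comm (r A) 1))
                      (r-∪-≤ A ⁅ x ⁆)

  independent-⊥ : Independent M ⊥
  independent-⊥ = trans r-⊥ (sym (∣⊥∣≡0 n))

  independent-⊆ : ∀ {I S} → Independent M I → S ⊆ I → Independent M S
  independent-⊆ {I} {S} I-indep S⊆I =
    ℕ.≤-antisym (r-bounded S) (ℕ.+-cancelʳ-≤ ∣ I ─ S ∣ ∣ S ∣ (r S) (begin
      ∣ S ∣ ℕ.+ ∣ I ─ S ∣   ≡⟨ ∣∪∣-disjoint {p = S} {I ─ S} x∈q⇒x∉p─q ⟨
      ∣ S ∪ (I ─ S) ∣       ≤⟨ p⊆q⇒∣p∣≤∣q∣ (∪-lub S⊆I (p─q⊆p I S)) ⟩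
      ∣ I ∣                 ≡⟨ I-indep ⟨
      r I                   ≤⟨ r-mono I (S ∪ (I ─ S)) I⊆S∪[I─S] ⟩
      r (S ∪ (I ─ S))       ≤⟨ r-∪-≤ S (I ─ S) ⟩
      r S ℕ.+ ∣ I ─ S ∣     ∎))
    where
    open ℕ.≤-Reasoning
    I⊆S∪[I─S] : I ⊆ S ∪ (I ─ S)
    I⊆S∪[I─S] {x} x∈I with x ∈? S
    ... | yes x∈S = x∈p∪q⁺ (inj₁ x∈S)
    ... | no  x∉S = x∈p∪q⁺ (inj₂ (x∈p∧x∉q⇒x∈p─q x∈I x∉S))

  r-∪-cong : ∀ {I S} A → I ⊆ S → r I ≡ r S → r (I ∪ A) ≡ r (S ∪ A)
  r-∪-cong {I} {S} A I⊆S rI≡rS = ℕ.≤-antisym (r-mono _ _ (∪-mono I⊆S id))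
    (ℕ.+-cancelʳ-≤ (r I) (r (S ∪ A)) (r (I ∪ A)) (begin
      r (S ∪ A) ℕ.+ r I     ≤⟨ r-submod-⊆ S∪A⊆ I⊆ ⟩
      r (I ∪ A) ℕ.+ r S     ≡⟨ cong (r (I ∪ A) ℕ.+_) rI≡rS ⟨
      r (I ∪ A) ℕ.+ r I     ∎))
    where
    open ℕ.≤-Reasoning
    S∪A⊆ : S ∪ A ⊆ (I ∪ A) ∪ S
    S∪A⊆ = ∪-lub (q⊆p∪q (I ∪ A) S) (⊆-trans (q⊆p∪q I A) (p⊆p∪q S))
    I⊆ : I ⊆ (I ∪ A) ∩ S
    I⊆ x∈I = x∈p∩q⁺ (p⊆p∪q A x∈I , I⊆S x∈I)

  record IsBasisOf (J S : Subset n) : Set where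
    field
      ⊆-set       : J ⊆ S
      independent : Independent M J
      spanning    : r J ≡ r S

  open IsBasisOf

  augment : ∀ {J S e} → e ∈ S → IsBasisOf J (S - e) → ∃[ J′ ] (J ⊆ J′ × IsBasisOf J′ S)
  augment {J} {S} {e} e∈S J-basis = add-e-or-not (r (J ∪ ⁅ e ⁆) ℕ.≟ ∣ J ∪ ⁅ e ⁆ ∣)
    where
    open ℕ.≤-Reasoning
    e⊆S : ⁅ e ⁆ ⊆ S
    e⊆S = x∈p⇒⁅x⁆⊆p e∈S
    J⊆S : J ⊆ S
    J⊆S = ⊆-trans (⊆-set J-basis) (p─q⊆p S ⁅ e ⁆)
    r-S : r S ≡ r ((S - e) ∪ ⁅ e ⁆)
    r-S = cong r (sym (p-x∪⁅x⁆≡p e∈S))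
    r-J≡r-S-e : r J ≡ r (S - e)
    r-J≡r-S-e = spanning J-basis
    ∣J+e∣ : ∣ J ∪ ⁅ e ⁆ ∣ ≡ suc (r J)
    ∣J+e∣ = trans (∣p∪⁅x⁆∣ (x∉p-x S e ∘ ⊆-set J-basis)) (cong suc (sym (independent J-basis)))

    add-e-or-not : Dec (Independent M (J ∪ ⁅ e ⁆)) → ∃[ J′ ] (J ⊆ J′ × IsBasisOf J′ S)
    add-e-or-not (yes J+e-indep) = J ∪ ⁅ e ⁆ , p⊆p∪q ⁅ e ⁆ , record
      { ⊆-set       = ∪-lub J⊆S e⊆S
      ; independent = J+e-indep
      ; spanning    = ℕ.≤-antisym (r-mono _ _ (∪-lub J⊆S e⊆S)) (begin
          r S                     ≡⟨ r-S ⟩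
          r ((S - e) ∪ ⁅ e ⁆)     ≤⟨ r-∪⁅⁆-≤ (S - e) e ⟩
          suc (r (S - e))         ≡⟨ cong suc r-J≡r-S-e ⟨
          suc (r J)               ≡⟨ ∣J+e∣ ⟨
          ∣ J ∪ ⁅ e ⁆ ∣           ≡⟨ J+e-indep ⟨
          r (J ∪ ⁅ e ⁆)           ∎)
      }
    add-e-or-not (no J+e-dependent) = J , id , record
      { ⊆-set       = J⊆S
      ; independent = independent J-basis
      ; spanning    = ℕ.≤-antisym (r-mono _ _ J⊆S) (begin
          r S                     ≡⟨ r-S ⟩
          r ((S - e) ∪ ⁅ e ⁆)     ≡⟨ r-∪-cong ⁅ e ⁆ (⊆-set J-basis) r-J≡r-S-e ⟨
          r (J ∪ ⁅ e ⁆)           ≤⟨ ℕ.≤-pred (ℕ.≤∧≢⇒< (r-∪⁅⁆-≤ J e)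
                                       (λ r≡suc → J+e-dependent (trans r≡suc (sym ∣J+e∣)))) ⟩
          r J                     ∎)
      }

  extend-to-basis : ∀ {I S} → Independent M I → I ⊆ S → ∃[ J ] (I ⊆ J × IsBasisOf J S)
  extend-to-basis {S = S} = extend-acc (⊂-wellFounded S)
    where
    extend-acc : ∀ {I S} → Acc _⊂_ S → Independent M I → I ⊆ S → ∃[ J ] (I ⊆ J × IsBasisOf J S)
    extend-acc {I} {S} (acc smaller) I-indep I⊆S with ⊆-or-witness S I
    ... | inj₁ S⊆I = I , id , record
      { ⊆-set = I⊆S ; independent = I-indep ; spanning = cong r (⊆-antisym I⊆S S⊆I) }
    ... | inj₂ (e , e∈S , e∉I)
      with extend-acc (smaller (x∈p⇒p-x⊂p e∈S)) I-indep (p⊆q∧x∉p⇒p⊆q-x I⊆S e∉I)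
    ...   | J , I⊆J , J-basis with augment e∈S J-basis
    ...     | J′ , J⊆J′ , J′-basis = J′ , ⊆-trans I⊆J J⊆J′ , J′-basis

  basis-exists : ∀ S → ∃[ J ] IsBasisOf J S
  basis-exists S with extend-to-basis independent-⊥ (⊥⊆ {p = S})
  ... | J , _ , J-basis = J , J-basis

  basis-of-⊤⇒base : ∀ {B} → IsBasisOf B ⊤ → IsBase M B
  basis-of-⊤⇒base B-basis = independent B-basis , trans (sym (independent B-basis)) (spanning B-basis)

  r⊤≤∣B∩Y∣+r[∁Y] : ∀ {B} → IsBase M B → ∀ Y → r ⊤ ℕ.≤ ∣ B ∩ Y ∣ ℕ.+ r (∁ Y)
  r⊤≤∣B∩Y∣+r[∁Y] {B} (B-indep , ∣B∣≡r⊤) Y = begin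
    r ⊤                        ≡⟨ trans (sym ∣B∣≡r⊤) (sym B-indep) ⟩
    r B                        ≤⟨ r-mono _ _ (p⊆∁q∪[p∩q] B Y) ⟩
    r (∁ Y ∪ (B ∩ Y))          ≤⟨ r-∪-≤ (∁ Y) (B ∩ Y) ⟩
    r (∁ Y) ℕ.+ ∣ B ∩ Y ∣      ≡⟨ ℕ.+-comm (r (∁ Y)) ∣ B ∩ Y ∣ ⟩
    ∣ B ∩ Y ∣ ℕ.+ r (∁ Y)      ∎
    where open ℕ.≤-Reasoning

  IsCircuit : Subset n → Set
  IsCircuit C = r C ℕ.< ∣ C ∣ × (∀ D → D ⊆ C → ¬ D ≡ C → Independent M D)

  circuit-nonempty : ∀ {C} → IsCircuit C → Nonempty C
  circuit-nonempty {C} (dependent , _) = decidable-stable (nonempty? C) λ C-empty →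
    ℕ.n≮0 (subst (r C ℕ.<_) (trans (cong ∣_∣ (Empty-unique C-empty)) (∣⊥∣≡0 n)) dependent)

  dependent⇒circuit : ∀ {D} → r D ℕ.< ∣ D ∣ → ∃[ C ] (C ⊆ D × IsCircuit C)
  dependent⇒circuit {D} = circuit-acc (⊂-wellFounded D)
    where
    circuit-acc : ∀ {D} → Acc _⊂_ D → r D ℕ.< ∣ D ∣ → ∃[ C ] (C ⊆ D × IsCircuit C)
    circuit-acc {D} (acc smaller) dependent
      with any? (λ e → e ∈? D ×-dec ¬? (r (D - e) ℕ.≟ ∣ D - e ∣))
    ... | yes (e , e∈D , D-e-dependent)
      with circuit-acc (smaller (x∈p⇒p-x⊂p e∈D)) (ℕ.≤∧≢⇒< (r-bounded (D - e)) D-e-dependent)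
    ...   | C , C⊆D-e , C-circuit = C , ⊆-trans C⊆D-e (p─q⊆p D ⁅ e ⁆) , C-circuit
    circuit-acc {D} (acc smaller) dependent | no no-dependent-D-e = D , id , dependent , minimal
      where
      minimal : ∀ D′ → D′ ⊆ D → ¬ D′ ≡ D → Independent M D′
      minimal D′ D′⊆D D′≢D with ⊆-or-witness D D′
      ... | inj₁ D⊆D′ = contradiction (⊆-antisym D′⊆D D⊆D′) D′≢D
      ... | inj₂ (e , e∈D , e∉D′) =
        independent-⊆ (decidable-stable (r (D - e) ℕ.≟ ∣ D - e ∣) (λ D-e-dep → no-dependent-D-e (e , e∈D , D-e-dep)))
                      (p⊆q∧x∉p⇒p⊆q-x D′⊆D e∉D′)

  circuit-minus-independent : ∀ {C e} → IsCircuit C → e ∈ C → Independent M (C - e)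
  circuit-minus-independent {C} {e} (_ , minimal) e∈C =
    minimal (C - e) (p─q⊆p C ⁅ e ⁆) (λ C-e≡C → x∉p-x C e (subst (e ∈_) (sym C-e≡C) e∈C))

  independent⇒circuit-free : ∀ {C J} → IsCircuit C → Independent M J → ¬ C ⊆ J
  independent⇒circuit-free (dependent , _) J-indep C⊆J = ℕ.<-irrefl (independent-⊆ J-indep C⊆J) dependent

  circuit-⊈-independent : ∀ {C J f} → IsCircuit C → Independent M J → C - f ⊆ J → f ∉ J
  circuit-⊈-independent {C} {J} {f} C-circuit J-indep C-f⊆J f∈J =
    independent⇒circuit-free C-circuit J-indep C⊆J
    where
    C⊆J : C ⊆ J
    C⊆J {x} x∈C with x Fin.≟ f
    ... | yes refl = f∈J
    ... | no  x≢f  = C-f⊆J (x∈p∧x≢y⇒x∈p-y x∈C x≢f)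

  circuit-rank-bound : ∀ {C J A e} → IsCircuit C → e ∈ C → Independent M J →
                       J ⊆ A ∪ C → C - e ⊆ A ∩ C → ∣ J ∣ ℕ.≤ r A
  circuit-rank-bound {C} {J} {A} {e} C-circuit@(C-dependent , _) e∈C J-indep J⊆A∪C C-e⊆A∩C =
    ℕ.+-cancelʳ-≤ ∣ C - e ∣ ∣ J ∣ (r A) (begin
      ∣ J ∣ ℕ.+ ∣ C - e ∣    ≡⟨ cong₂ ℕ._+_ J-indep (circuit-minus-independent C-circuit e∈C) ⟨
      r J ℕ.+ r (C - e)      ≤⟨ r-submod-⊆ J⊆A∪C C-e⊆A∩C ⟩
      r A ℕ.+ r C            ≤⟨ ℕ.+-monoʳ-≤ (r A) (ℕ.≤-pred (subst (r C ℕ.<_) (sym (∣p-x∣ e∈C)) C-dependent)) ⟩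
      r A ℕ.+ ∣ C - e ∣      ∎)
    where open ℕ.≤-Reasoning

  circuit-exchange : ∀ {C J S e f} → IsCircuit C → C ⊆ S → e ∈ C → f ∈ C → e ≢ f →
                     IsBasisOf J S → C - f ⊆ J → IsBasisOf ((J - e) ∪ ⁅ f ⁆) S
  circuit-exchange {C} {J} {S} {e} {f} C-circuit C⊆S e∈C f∈C e≢f J-basis C-f⊆J = record
    { ⊆-set       = A⊆S
    ; independent = ℕ.≤-antisym (r-bounded A) (subst (ℕ._≤ r A) (sym ∣A∣≡∣J∣) ∣J∣≤rA)
    ; spanning    = ℕ.≤-antisym (r-mono _ _ A⊆S)
                      (subst (ℕ._≤ r A) (trans (sym (independent J-basis)) (spanning J-basis)) ∣J∣≤rA)
    }
    where
    A : Subset n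
    A = (J - e) ∪ ⁅ f ⁆
    f∉J : f ∉ J
    f∉J = circuit-⊈-independent C-circuit (independent J-basis) C-f⊆J
    e∈J : e ∈ J
    e∈J = C-f⊆J (x∈p∧x≢y⇒x∈p-y e∈C e≢f)
    A⊆S : A ⊆ S
    A⊆S = ∪-lub (⊆-trans (p─q⊆p J ⁅ e ⁆) (⊆-set J-basis)) (⊆-trans (x∈p⇒⁅x⁆⊆p f∈C) C⊆S)
    ∣A∣≡∣J∣ : ∣ A ∣ ≡ ∣ J ∣
    ∣A∣≡∣J∣ = trans (∣p∪⁅x⁆∣ (f∉J ∘ p─q⊆p J ⁅ e ⁆)) (∣p-x∣ e∈J)
    J⊆A∪C : J ⊆ A ∪ C
    J⊆A∪C {x} x∈J with x Fin.≟ e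
    ... | yes refl = q⊆p∪q A C e∈C
    ... | no  x≢e  = p⊆p∪q C (p⊆p∪q ⁅ f ⁆ (x∈p∧x≢y⇒x∈p-y x∈J x≢e))
    C-e⊆A∩C : C - e ⊆ A ∩ C
    C-e⊆A∩C {x} x∈C-e = x∈p∩q⁺ (x∈A , p─q⊆p C ⁅ e ⁆ x∈C-e)
      where
      x∈A : x ∈ A
      x∈A with x Fin.≟ f
      ... | yes refl = q⊆p∪q (J - e) ⁅ f ⁆ (x∈⁅x⁆ f)
      ... | no  x≢f  = p⊆p∪q ⁅ f ⁆ (x∈p∧x≢y⇒x∈p-y
                         (C-f⊆J (x∈p∧x≢y⇒x∈p-y (p─q⊆p C ⁅ e ⁆ x∈C-e) x≢f)) (x∈p-y⇒x≢y x∈C-e))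
    ∣J∣≤rA : ∣ J ∣ ℕ.≤ r A
    ∣J∣≤rA = circuit-rank-bound C-circuit e∈C (independent J-basis) J⊆A∪C C-e⊆A∩C

  -- Exchanging e for f along C turns one basis of S into another.
  equal-basis-sums⇒circuit-constant : ∀ {S s} (σ : Fin n → ℚ) → (∀ {J} → IsBasisOf J S → sumOver J σ ≡ s) →
                     ∀ {C} → IsCircuit C → C ⊆ S → ∀ {e f} → e ∈ C → f ∈ C → σ e ≡ σ f
  equal-basis-sums⇒circuit-constant {S} {s} σ basis-sum {C} C-circuit C⊆S {e} {f} e∈C f∈C with e Fin.≟ f
  ... | yes refl = refl
  ... | no  e≢f
    with extend-to-basis (circuit-minus-independent C-circuit f∈C) (⊆-trans (p─q⊆p C ⁅ f ⁆) C⊆S)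
  ...   | J , C-f⊆J , J-basis = ∙-cancelˡ (sumOver (J - e) σ) (σ e) (σ f) (begin
    sumOver (J - e) σ ℚ.+ σ e        ≡⟨ sumOver-∪⁅⁆ σ (x∉p-x J e) ⟨
    sumOver ((J - e) ∪ ⁅ e ⁆) σ      ≡⟨ cong (λ B → sumOver B σ) (p-x∪⁅x⁆≡p e∈J) ⟩
    sumOver J σ                      ≡⟨ basis-sum J-basis ⟩
    s                                ≡⟨ basis-sum (circuit-exchange C-circuit C⊆S e∈C f∈C e≢f J-basis C-f⊆J) ⟨
    sumOver ((J - e) ∪ ⁅ f ⁆) σ      ≡⟨ sumOver-∪⁅⁆ σ f∉J-e ⟩
    sumOver (J - e) σ ℚ.+ σ f        ∎)
    where
    open ≡-Reasoning
    e∈J : e ∈ J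
    e∈J = C-f⊆J (x∈p∧x≢y⇒x∈p-y e∈C e≢f)
    f∉J-e : f ∉ J - e
    f∉J-e f∈J-e = circuit-⊈-independent C-circuit (independent J-basis) C-f⊆J (p─q⊆p J ⁅ e ⁆ f∈J-e)

  circuit-free⇒independent : ∀ {D} → (∀ {C} → C ⊆ D → ¬ IsCircuit C) → Independent M D
  circuit-free⇒independent {D} circuit-free = decidable-stable (r D ℕ.≟ ∣ D ∣) λ dependent →
    let C , C⊆D , C-circuit = dependent⇒circuit (ℕ.≤∧≢⇒< (r-bounded D) dependent)
    in  circuit-free C⊆D C-circuit

  separator-rank : ∀ {X Z} → Z ⊆ X → (∀ C → C ⊆ X → IsCircuit C → C ⊆ Z ⊎ C ⊆ X ∩ ∁ Z) →
                   r Z ℕ.+ r (X ∩ ∁ Z) ≡ r X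
  separator-rank {X} {Z} Z⊆X separates = ℕ.≤-antisym additive subadditive
    where
    open ℕ.≤-Reasoning
    subadditive : r X ℕ.≤ r Z ℕ.+ r (X ∩ ∁ Z)
    subadditive = begin
      r X                      ≡⟨ ℕ.+-identityʳ (r X) ⟨
      r X ℕ.+ 0                ≡⟨ cong (r X ℕ.+_) r-⊥ ⟨
      r X ℕ.+ r ⊥              ≤⟨ r-submod-⊆ (p⊆q∪[p∩∁q] X Z) ⊥⊆ ⟩
      r Z ℕ.+ r (X ∩ ∁ Z)      ∎
    Z′-outside : Disjoint (X ∩ ∁ Z) Z
    Z′-outside x∈Z′ = x∈∁p⇒x∉p (proj₂ (x∈p∩q⁻ X (∁ Z) x∈Z′))
    I I′ : Subset n
    I  = proj₁ (basis-exists Z)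
    I′ = proj₁ (basis-exists (X ∩ ∁ Z))
    I-basis : IsBasisOf I Z
    I-basis = proj₂ (basis-exists Z)
    I′-basis : IsBasisOf I′ (X ∩ ∁ Z)
    I′-basis = proj₂ (basis-exists (X ∩ ∁ Z))
    I∪I′⊆X : I ∪ I′ ⊆ X
    I∪I′⊆X = ∪-lub (⊆-trans (⊆-set I-basis) Z⊆X) (⊆-trans (⊆-set I′-basis) (p∩q⊆p X (∁ Z)))
    disjoint : Disjoint I I′
    disjoint x∈I x∈I′ = Z′-outside (⊆-set I′-basis x∈I′) (⊆-set I-basis x∈I)
    circuit-free : ∀ {C} → C ⊆ I ∪ I′ → ¬ IsCircuit C
    circuit-free C⊆I∪I′ C-circuit with separates _ (⊆-trans C⊆I∪I′ I∪I′⊆X) C-circuit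
    ... | inj₁ C⊆Z  = independent⇒circuit-free C-circuit (independent I-basis)
                        (⊆∪⇒⊆ˡ C⊆I∪I′ (λ x∈C x∈I′ → Z′-outside (⊆-set I′-basis x∈I′) (C⊆Z x∈C)))
    ... | inj₂ C⊆Z′ = independent⇒circuit-free C-circuit (independent I′-basis)
                        (⊆∪⇒⊆ʳ C⊆I∪I′ (λ x∈C x∈I → Z′-outside (C⊆Z′ x∈C) (⊆-set I-basis x∈I)))
    additive : r Z ℕ.+ r (X ∩ ∁ Z) ℕ.≤ r X
    additive = begin
      r Z ℕ.+ r (X ∩ ∁ Z)      ≡⟨ cong₂ ℕ._+_ (trans (sym (spanning I-basis)) (independent I-basis))
                                               (trans (sym (spanning I′-basis)) (independent I′-basis)) ⟩
      ∣ I ∣ ℕ.+ ∣ I′ ∣          ≡⟨ ∣∪∣-disjoint disjoint ⟨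
      ∣ I ∪ I′ ∣               ≡⟨ circuit-free⇒independent circuit-free ⟨
      r (I ∪ I′)               ≤⟨ r-mono _ _ I∪I′⊆X ⟩
      r X                      ∎

  IsClosed : Subset n → Set
  IsClosed Z = ∀ {y} → y ∉ Z → r Z ℕ.< r (Z ∪ ⁅ y ⁆)

  cl-fixed⇒closed : ∀ {Z} → cl M Z ≡ Z → IsClosed Z
  cl-fixed⇒closed {Z} cl-fixed {y} y∉Z = ℕ.≤∧≢⇒< (r-mono _ _ (p⊆p∪q ⁅ y ⁆)) λ r-Z≡ →
    y∉Z (subst (y ∈_) cl-fixed (∈-satisfying⁺ (λ y → r (Z ∪ ⁅ y ⁆) ℕ.≟ r Z) (sym r-Z≡)))

  closed⇒cl-fixed : ∀ {Z} → IsClosed Z → cl M Z ≡ Z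
  closed⇒cl-fixed {Z} closed = ⊆-antisym cl⊆Z Z⊆cl
    where
    cl⊆Z : cl M Z ⊆ Z
    cl⊆Z {y} y∈cl = decidable-stable (y ∈? Z) λ y∉Z →
      ℕ.<-irrefl (sym (∈-satisfying⁻ (λ y → r (Z ∪ ⁅ y ⁆) ℕ.≟ r Z) y∈cl)) (closed y∉Z)
    Z⊆cl : Z ⊆ cl M Z
    Z⊆cl {y} y∈Z = ∈-satisfying⁺ (λ y → r (Z ∪ ⁅ y ⁆) ℕ.≟ r Z)
      (cong r (⊆-antisym (∪-lub id (x∈p⇒⁅x⁆⊆p y∈Z)) (p⊆p∪q ⁅ y ⁆)))

∸-+-distrib : ∀ {a b c} → c ℕ.≤ a → c ℕ.≤ b → (a ∸ c) ℕ.+ (b ∸ c) ≡ (a ℕ.+ b) ∸ (c ℕ.+ c)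
∸-+-distrib {a} {b} {c} c≤a c≤b = begin
  (a ∸ c) ℕ.+ (b ∸ c)     ≡⟨ ℕ.+-∸-comm (b ∸ c) c≤a ⟨
  (a ℕ.+ (b ∸ c)) ∸ c     ≡⟨ cong (_∸ c) (ℕ.+-∸-assoc a c≤b) ⟨
  (a ℕ.+ b) ∸ c ∸ c       ≡⟨ ℕ.∸-+-assoc (a ℕ.+ b) c c ⟩
  (a ℕ.+ b) ∸ (c ℕ.+ c)   ∎
  where open ≡-Reasoning

contraction : ∀ {n} → Matroid n → Subset n → Matroid n
contraction M C = record
  { r         = λ W → r (W ∪ C) ∸ r C
  ; r-bounded = λ W → ℕ.m≤n+o⇒m∸n≤o (r (W ∪ C)) (r C) (subst (ℕ._≤ r C ℕ.+ ∣ W ∣) (cong r (∪-comm C W)) (r-∪-≤ C W))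
  ; r-mono    = λ W V W⊆V → ℕ.∸-monoˡ-≤ (r C) (r-mono (W ∪ C) (V ∪ C) (∪-mono W⊆V id))
  ; r-submod  = λ W V → begin
      (r ((W ∪ V) ∪ C) ∸ r C) ℕ.+ (r ((W ∩ V) ∪ C) ∸ r C)   ≡⟨ ∸-+-distrib (above (W ∪ V)) (above (W ∩ V)) ⟩
      (r ((W ∪ V) ∪ C) ℕ.+ r ((W ∩ V) ∪ C)) ∸ (r C ℕ.+ r C) ≤⟨ ℕ.∸-monoˡ-≤ (r C ℕ.+ r C)
                                                                 (r-submod-⊆ (∪-mono-∪ W V) (∩-∪ W V)) ⟩
      (r (W ∪ C) ℕ.+ r (V ∪ C)) ∸ (r C ℕ.+ r C)             ≡⟨ ∸-+-distrib (above W) (above V) ⟨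
      (r (W ∪ C) ∸ r C) ℕ.+ (r (V ∪ C) ∸ r C)               ∎
  }
  where
  open Matroid M
  open MatroidTheory M
  open ℕ.≤-Reasoning
  above : ∀ W → r C ℕ.≤ r (W ∪ C)
  above W = r-mono C (W ∪ C) (q⊆p∪q W C)
  ∪-mono-∪ : ∀ W V → (W ∪ V) ∪ C ⊆ (W ∪ C) ∪ (V ∪ C)
  ∪-mono-∪ W V = ∪-lub (∪-mono (p⊆p∪q C) (p⊆p∪q C)) (⊆-trans (q⊆p∪q W C) (p⊆p∪q (V ∪ C)))
  ∩-∪ : ∀ W V → (W ∩ V) ∪ C ⊆ (W ∪ C) ∩ (V ∪ C)
  ∩-∪ W V = ∪-lub (λ x∈W∩V → let x∈W , x∈V = x∈p∩q⁻ W V x∈W∩V in x∈p∩q⁺ (p⊆p∪q C x∈W , p⊆p∪q C x∈V))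
                  (λ x∈C → x∈p∩q⁺ (q⊆p∪q W C x∈C , q⊆p∪q V C x∈C))

-- The blocker of the base family

module Blocker {n : ℕ} (M : Matroid n) where
  open Matroid M
  open MatroidTheory M
  open IsBasisOf

  Adm-upwardClosed : UpwardClosed (Adm M)
  Adm-upwardClosed (ρ≥0 , ρ-covers) ρ≤σ =
    (λ e → ℚ.≤-trans (ρ≥0 e) (ρ≤σ e)) , λ B B-base → ℚ.≤-trans (ρ-covers B B-base) (sumOver-mono B ρ≤σ)

  Adm-scaledIndicator : ∀ c .{{_ : NonZero c}} Y → c ℕ.+ r (∁ Y) ℕ.≤ r ⊤ →
                        Adm M (scaledIndicator (inv c) Y)
  Adm-scaledIndicator c Y c+r[∁Y]≤r⊤ = scaledIndicator-nonNeg {X = Y} (inv-nonNeg c) , λ B B-base → begin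
    1ℚ                                     ≡⟨ inv-*-fromℕ c ⟨
    inv c ℚ.* fromℕ c                      ≤⟨ ℚ.*-monoˡ-≤-nonNeg (inv c) {{ℚ.nonNegative (inv-nonNeg c)}}
                                                (fromℕ-mono-≤ (c≤∣B∩Y∣ B-base)) ⟩
    inv c ℚ.* fromℕ ∣ B ∩ Y ∣              ≡⟨ sumOver-indicator B Y (inv c) ⟨
    sumOver B (scaledIndicator (inv c) Y)  ∎
    where
    open ℚ.≤-Reasoning
    c≤∣B∩Y∣ : ∀ {B} → IsBase M B → c ℕ.≤ ∣ B ∩ Y ∣
    c≤∣B∩Y∣ {B} B-base = ℕ.+-cancelʳ-≤ (r (∁ Y)) c ∣ B ∩ Y ∣ (ℕ.≤-trans c+r[∁Y]≤r⊤ (r⊤≤∣B∩Y∣+r[∁Y] B-base Y))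

  module Candidate (X : Subset n) where

    -- Its rank function is contrRank M X, and IsCircuitOfContr M X C unfolds to C ⊆ X × M/∁X.IsCircuit C.
    M/∁X : Matroid n
    M/∁X = contraction M (∁ X)

    module M/∁X = MatroidTheory M/∁X

    k : ℕ
    k = r ⊤ ∸ r (∁ X)

    θ : Fin n → ℚ
    θ = scaledIndicator (inv k) X

    k+r[∁X]≡r⊤ : k ℕ.+ r (∁ X) ≡ r ⊤
    k+r[∁X]≡r⊤ = ℕ.m∸n+n≡m (r-mono (∁ X) ⊤ ⊆⊤)

    contraction-rank : ∀ W → contrRank M X W ℕ.+ r (∁ X) ≡ r (W ∪ ∁ X)
    contraction-rank W = ℕ.m∸n+n≡m (r-mono (∁ X) (W ∪ ∁ X) (q⊆p∪q W (∁ X)))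

    rank-X : contrRank M X X ≡ k
    rank-X = cong (λ S → r S ∸ r (∁ X)) (p∪∁p≡⊤ X)

    basis-size : ∀ {J} → M/∁X.IsBasisOf J X → ∣ J ∣ ≡ k
    basis-size J-basis = trans (sym (M/∁X.IsBasisOf.independent J-basis))
                               (trans (M/∁X.IsBasisOf.spanning J-basis) rank-X)

    I₀ : Subset n
    I₀ = proj₁ (basis-exists (∁ X))

    I₀-basis : IsBasisOf I₀ (∁ X)
    I₀-basis = proj₂ (basis-exists (∁ X))

    disjoint-I₀ : ∀ {J} → J ⊆ X → Disjoint J I₀
    disjoint-I₀ J⊆X x∈J x∈I₀ = x∈∁p⇒x∉p (⊆-set I₀-basis x∈I₀) (J⊆X x∈J)

    tight-base : ∀ {J} → J ⊆ X → Independent M/∁X J → ∣ J ∣ ≡ k → IsBase M (J ∪ I₀)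
    tight-base {J} J⊆X J-indep ∣J∣≡k = independent-J∪I₀ , (begin
      ∣ J ∪ I₀ ∣               ≡⟨ ∣J∪I₀∣ ⟩
      ∣ J ∣ ℕ.+ r (∁ X)        ≡⟨ cong (ℕ._+ r (∁ X)) ∣J∣≡k ⟩
      k ℕ.+ r (∁ X)            ≡⟨ k+r[∁X]≡r⊤ ⟩
      r ⊤                      ∎)
      where
      open ≡-Reasoning
      ∣J∪I₀∣ : ∣ J ∪ I₀ ∣ ≡ ∣ J ∣ ℕ.+ r (∁ X)
      ∣J∪I₀∣ = trans (∣∪∣-disjoint {p = J} {I₀} (disjoint-I₀ J⊆X))
                     (cong (∣ J ∣ ℕ.+_) (trans (sym (independent I₀-basis)) (spanning I₀-basis)))
      independent-J∪I₀ : Independent M (J ∪ I₀)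
      independent-J∪I₀ = begin
        r (J ∪ I₀)                           ≡⟨ cong r (∪-comm J I₀) ⟩
        r (I₀ ∪ J)                           ≡⟨ r-∪-cong J (⊆-set I₀-basis) (spanning I₀-basis) ⟩
        r (∁ X ∪ J)                          ≡⟨ cong r (∪-comm (∁ X) J) ⟩
        r (J ∪ ∁ X)                          ≡⟨ contraction-rank J ⟨
        contrRank M X J ℕ.+ r (∁ X)         ≡⟨ cong (ℕ._+ r (∁ X)) J-indep ⟩
        ∣ J ∣ ℕ.+ r (∁ X)                    ≡⟨ ∣J∪I₀∣ ⟨
        ∣ J ∪ I₀ ∣                           ∎

    sumOver-∪I₀ : ∀ {J} (σ : Fin n → ℚ) → (∀ {e} → e ∉ X → σ e ≡ 0ℚ) → J ⊆ X →
                         sumOver (J ∪ I₀) σ ≡ sumOver J σ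
    sumOver-∪I₀ {J} σ σ-outside J⊆X = begin
      sumOver (J ∪ I₀) σ           ≡⟨ sumOver-∪ σ (disjoint-I₀ J⊆X) ⟩
      sumOver J σ ℚ.+ sumOver I₀ σ ≡⟨ cong (sumOver J σ ℚ.+_)
                                          (sumOver-zero I₀ (σ-outside ∘ x∈∁p⇒x∉p ∘ ⊆-set I₀-basis)) ⟩
      sumOver J σ ℚ.+ 0ℚ           ≡⟨ ℚ.+-identityʳ (sumOver J σ) ⟩
      sumOver J σ                  ∎
      where open ≡-Reasoning

    closed-contraction-rank-pos : IsClosed (∁ X) → ∀ {x W} → x ∈ X → x ∈ W → 0 ℕ.< contrRank M X W
    closed-contraction-rank-pos closed {x} {W} x∈X x∈W = ℕ.m<n⇒0<n∸m (ℕ.<-≤-trans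
      (closed (x∈p⇒x∉∁p x∈X))
      (r-mono _ _ (∪-lub (q⊆p∪q W (∁ X)) (⊆-trans (x∈p⇒⁅x⁆⊆p x∈W) (p⊆p∪q (∁ X))))))

    k-pos : Nonempty X → IsClosed (∁ X) → 0 ℕ.< k
    k-pos (x , x∈X) closed = subst (0 ℕ.<_) rank-X (closed-contraction-rank-pos closed x∈X x∈X)

    θ-admissible : .{{_ : NonZero k}} → Adm M θ
    θ-admissible = Adm-scaledIndicator k X (ℕ.≤-reflexive k+r[∁X]≡r⊤)

    sumOver-θ : .{{_ : NonZero k}} → ∀ {J} → J ⊆ X → ∣ J ∣ ≡ k → sumOver J θ ≡ 1ℚ
    sumOver-θ {J} J⊆X ∣J∣≡k = begin
      sumOver J θ              ≡⟨ sumOver-const J (inv k) (scaledIndicator-∈ (inv k) ∘ J⊆X) ⟩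
      inv k ℚ.* fromℕ ∣ J ∣    ≡⟨ cong (λ m → inv k ℚ.* fromℕ m) ∣J∣≡k ⟩
      inv k ℚ.* fromℕ k        ≡⟨ inv-*-fromℕ k ⟩
      1ℚ                       ∎
      where open ≡-Reasoning

    θ-outside : ∀ {e} → e ∉ X → θ e ≡ 0ℚ
    θ-outside = scaledIndicator-∉ (inv k)

    -- The level set of σ through e is a separator of M/∁X.
    connected⇒constant : ContrConnected M X → ∀ {A : Set} → DecidableEquality A → (σ : Fin n → A) →
                         (∀ {C} → IsCircuitOfContr M X C → ∀ {e f} → e ∈ C → f ∈ C → σ e ≡ σ f) →
                         ∀ {e f} → e ∈ X → f ∈ X → σ e ≡ σ f
    connected⇒constant connected {A} _≟_ σ circuit-constant {e} {f} e∈X f∈X =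
      case connected level-set (p∩q⊆p X _ , separates) of λ where
        (inj₁ level-set≡⊥) → contradiction (subst (e ∈_) level-set≡⊥ (level-set⁺ e∈X refl)) ∉⊥
        (inj₂ level-set≡X) → sym (level-set⁻ (subst (f ∈_) (sym level-set≡X) f∈X))
      where
      level-set : Subset n
      level-set = X ∩ satisfying (λ x → σ x ≟ σ e)
      level-set⁺ : ∀ {x} → x ∈ X → σ x ≡ σ e → x ∈ level-set
      level-set⁺ x∈X σx≡σe = x∈p∩q⁺ (x∈X , ∈-satisfying⁺ (λ x → σ x ≟ σ e) σx≡σe)
      level-set⁻ : ∀ {x} → x ∈ level-set → σ x ≡ σ e
      level-set⁻ x∈level-set = ∈-satisfying⁻ (λ x → σ x ≟ σ e) (proj₂ (x∈p∩q⁻ X _ x∈level-set))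
      separates : ∀ C → IsCircuitOfContr M X C → C ⊆ level-set ⊎ C ⊆ X ∩ ∁ level-set
      separates C C-circuit@(C⊆X , _) with M/∁X.circuit-nonempty (proj₂ C-circuit)
      ... | c , c∈C with σ c ≟ σ e
      ...   | yes σc≡σe = inj₁ λ x∈C → level-set⁺ (C⊆X x∈C) (trans (circuit-constant C-circuit x∈C c∈C) σc≡σe)
      ...   | no  σc≢σe = inj₂ λ x∈C → x∈p∩q⁺ (C⊆X x∈C , x∉p⇒x∈∁p λ x∈level-set →
                            σc≢σe (trans (circuit-constant C-circuit c∈C x∈C) (level-set⁻ x∈level-set)))

    θ-unique : ContrConnected M X → (σ : Fin n → ℚ) → (∀ {e} → e ∉ X → σ e ≡ 0ℚ) →
               (∀ {J} → M/∁X.IsBasisOf J X → sumOver J σ ≡ 1ℚ) → ∀ e → σ e ≡ θ e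
    θ-unique connected σ σ-outside basis-sum e with e ∈? X
    ... | no  e∉X = trans (σ-outside e∉X) (sym (θ-outside e∉X))
    ... | yes e∈X = trans (*-fromℕ≡1⇒≡inv k σe*k≡1) (sym (scaledIndicator-∈ (inv k) e∈X))
      where
      constant : ∀ {x} → x ∈ X → σ x ≡ σ e
      constant x∈X = connected⇒constant connected ℚ._≟_ σ
        (λ (C⊆X , C-circuit) → M/∁X.equal-basis-sums⇒circuit-constant σ basis-sum C-circuit C⊆X) x∈X e∈X
      J₀ : Subset n
      J₀ = proj₁ (M/∁X.basis-exists X)
      J₀-basis : M/∁X.IsBasisOf J₀ X
      J₀-basis = proj₂ (M/∁X.basis-exists X)
      σe*k≡1 : σ e ℚ.* fromℕ k ≡ 1ℚ
      σe*k≡1 = begin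
        σ e ℚ.* fromℕ k          ≡⟨ cong (λ m → σ e ℚ.* fromℕ m) (basis-size J₀-basis) ⟨
        σ e ℚ.* fromℕ ∣ J₀ ∣     ≡⟨ sumOver-const J₀ (σ e) (constant ∘ M/∁X.IsBasisOf.⊆-set J₀-basis) ⟨
        sumOver J₀ σ             ≡⟨ basis-sum J₀-basis ⟩
        1ℚ                       ∎
        where open ≡-Reasoning

    module _ .{{_ : NonZero k}} {ρ ρ₁ ρ₂ : Fin n → ℚ} {t : ℚ} (ρ≗θ : ∀ e → ρ e ≡ θ e)
             (ρ₁-admissible : Adm M ρ₁) (ρ₂-admissible : Adm M ρ₂)
             (t>0 : 0ℚ ℚ.< t) (t<1 : t ℚ.< 1ℚ)
             (ρ≡ : ∀ e → ρ e ≡ t ℚ.* ρ₁ e ℚ.+ (1ℚ ℚ.- t) ℚ.* ρ₂ e) where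

      convex-outside : ∀ {e} → e ∉ X → ρ₁ e ≡ 0ℚ × ρ₂ e ≡ 0ℚ
      convex-outside {e} e∉X =
        convex-tight t>0 t<1 (proj₁ ρ₁-admissible e) (proj₁ ρ₂-admissible e)
                     (trans (sym (ρ≡ e)) (trans (ρ≗θ e) (θ-outside e∉X)))

      convex-basis-sums : ∀ {J} → M/∁X.IsBasisOf J X → sumOver J ρ₁ ≡ 1ℚ × sumOver J ρ₂ ≡ 1ℚ
      convex-basis-sums {J} J-basis =
        trans (sym (sumOver-∪I₀ ρ₁ (proj₁ ∘ convex-outside) J⊆X)) (proj₁ tight) ,
        trans (sym (sumOver-∪I₀ ρ₂ (proj₂ ∘ convex-outside) J⊆X)) (proj₂ tight)
        where
        open ≡-Reasoning
        J⊆X : J ⊆ X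
        J⊆X = M/∁X.IsBasisOf.⊆-set J-basis
        B-base : IsBase M (J ∪ I₀)
        B-base = tight-base J⊆X (M/∁X.IsBasisOf.independent J-basis) (basis-size J-basis)
        tight : sumOver (J ∪ I₀) ρ₁ ≡ 1ℚ × sumOver (J ∪ I₀) ρ₂ ≡ 1ℚ
        tight = convex-tight t>0 t<1 (proj₂ ρ₁-admissible _ B-base) (proj₂ ρ₂-admissible _ B-base) (begin
          t ℚ.* sumOver (J ∪ I₀) ρ₁ ℚ.+ (1ℚ ℚ.- t) ℚ.* sumOver (J ∪ I₀) ρ₂
              ≡⟨ sumOver-linear (J ∪ I₀) t (1ℚ ℚ.- t) ρ₁ ρ₂ ⟨
          sumOver (J ∪ I₀) (λ e → t ℚ.* ρ₁ e ℚ.+ (1ℚ ℚ.- t) ℚ.* ρ₂ e)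
              ≡⟨ sumOver-cong (J ∪ I₀) (λ {e} _ → trans (sym (ρ≡ e)) (ρ≗θ e)) ⟩
          sumOver (J ∪ I₀) θ
              ≡⟨ sumOver-∪I₀ θ θ-outside J⊆X ⟩
          sumOver J θ
              ≡⟨ sumOver-θ J⊆X (basis-size J-basis) ⟩
          1ℚ  ∎)

    θ-extreme : Nonempty X → IsClosed (∁ X) → ContrConnected M X →
                ∀ {ρ} → (∀ e → ρ e ≡ θ e) → IsExtremePoint (Adm M) ρ
    θ-extreme X-nonempty closed connected {ρ} ρ≗θ =
      Adm-upwardClosed θ-admissible (ℚ.≤-reflexive ∘ sym ∘ ρ≗θ) ,
      λ ρ₁ ρ₂ t ρ₁-adm ρ₂-adm t>0 t<1 ρ≡ e →
        let outside = convex-outside ρ≗θ ρ₁-adm ρ₂-adm t>0 t<1 ρ≡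
            sums    = convex-basis-sums ρ≗θ ρ₁-adm ρ₂-adm t>0 t<1 ρ≡
        in trans (θ-unique connected ρ₁ (proj₁ ∘ outside) (proj₁ ∘ sums) e)
                 (sym (θ-unique connected ρ₂ (proj₂ ∘ outside) (proj₂ ∘ sums) e))
      where
      instance
        k≢0 : NonZero k
        k≢0 = ℕ.>-nonZero (k-pos X-nonempty closed)

    rank-base-∩ : ∀ {B} → IsBase M B → contrRank M X (B ∩ X) ≡ k
    rank-base-∩ {B} (B-indep , ∣B∣≡r⊤) = cong (_∸ r (∁ X)) (ℕ.≤-antisym (r-mono _ ⊤ ⊆⊤) (begin
      r ⊤                     ≡⟨ trans (sym ∣B∣≡r⊤) (sym B-indep) ⟩
      r B                     ≤⟨ r-mono B _ (p⊆∁q∪[p∩q] B X) ⟩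
      r (∁ X ∪ (B ∩ X))       ≡⟨ cong r (∪-comm (∁ X) (B ∩ X)) ⟩
      r ((B ∩ X) ∪ ∁ X)       ∎))
      where open ℕ.≤-Reasoning

    Adm-part : ∀ {P Q} .{{_ : NonZero (contrRank M X P)}} → contrRank M X P ℕ.+ contrRank M X Q ≡ k →
               ∁ P ⊆ Q ∪ ∁ X → Adm M (scaledIndicator (inv (contrRank M X P)) P)
    Adm-part {P} {Q} p+q≡k ∁P⊆ = Adm-scaledIndicator (contrRank M X P) P (begin
      contrRank M X P ℕ.+ r (∁ P)                           ≤⟨ ℕ.+-monoʳ-≤ (contrRank M X P) (r-mono _ _ ∁P⊆) ⟩
      contrRank M X P ℕ.+ r (Q ∪ ∁ X)                       ≡⟨ cong (contrRank M X P ℕ.+_) (contraction-rank Q) ⟨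
      contrRank M X P ℕ.+ (contrRank M X Q ℕ.+ r (∁ X))     ≡⟨ ℕ.+-assoc (contrRank M X P) (contrRank M X Q) (r (∁ X)) ⟨
      contrRank M X P ℕ.+ contrRank M X Q ℕ.+ r (∁ X)       ≡⟨ cong (ℕ._+ r (∁ X)) p+q≡k ⟩
      k ℕ.+ r (∁ X)                                         ≡⟨ k+r[∁X]≡r⊤ ⟩
      r ⊤                                                   ∎)
      where open ℕ.≤-Reasoning

    θ-split : ∀ {Z a b} .{{_ : NonZero k}} .{{_ : NonZero a}} .{{_ : NonZero b}} → Z ⊆ X → a ℕ.+ b ≡ k →
              ∀ e → θ e ≡ inv k ℚ.* fromℕ a ℚ.* scaledIndicator (inv a) Z e
                          ℚ.+ (1ℚ ℚ.- inv k ℚ.* fromℕ a) ℚ.* scaledIndicator (inv b) (X ∩ ∁ Z) e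
    θ-split {a = a} {b} Z⊆X a+b≡k =
      scaledIndicator-split {c₁ = inv a} {inv b} {inv k ℚ.* fromℕ a} Z⊆X (*-fromℕ-*-inv (inv k) a)
      (trans (cong (ℚ._* inv b) (complementary-weight a+b≡k)) (*-fromℕ-*-inv (inv k) b))

    module _ .{{_ : NonZero k}} {ρ : Fin n → ℚ} (ρ-extreme : IsExtremePoint (Adm M) ρ)
             (ρ≗θ : ∀ e → ρ e ≡ θ e) where

      -- Otherwise the indicator of X - y, scaled by 1/k, is admissible and lies below θ.
      θ-extreme⇒closed : IsClosed (∁ X)
      θ-extreme⇒closed {y} y∉∁X = ℕ.≰⇒> r-grows
        where
        y∈X : y ∈ X
        y∈X = x∉∁p⇒x∈p y∉∁X
        r-grows : ¬ r (∁ X ∪ ⁅ y ⁆) ℕ.≤ r (∁ X)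
        r-grows r-stays = ℚ.<-irrefl 0≡inv-k (inv-pos k)
          where
          σ : Fin n → ℚ
          σ = scaledIndicator (inv k) (X - y)
          σ-admissible : Adm M σ
          σ-admissible = Adm-scaledIndicator k (X - y) (begin
            k ℕ.+ r (∁ (X - y))      ≤⟨ ℕ.+-monoʳ-≤ k (r-mono _ _ (∁[p-x]⊆∁p∪⁅x⁆ X y)) ⟩
            k ℕ.+ r (∁ X ∪ ⁅ y ⁆)    ≤⟨ ℕ.+-monoʳ-≤ k r-stays ⟩
            k ℕ.+ r (∁ X)            ≡⟨ k+r[∁X]≡r⊤ ⟩
            r ⊤                      ∎)
            where open ℕ.≤-Reasoning
          σ≡ρ : ∀ e → σ e ≡ ρ e
          σ≡ρ = extreme-minimal Adm-upwardClosed ρ-extreme σ-admissible λ e →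
            ℚ.≤-trans (scaledIndicator-mono (inv-nonNeg k) (p─q⊆p X ⁅ y ⁆) e) (ℚ.≤-reflexive (sym (ρ≗θ e)))
          0≡inv-k : 0ℚ ≡ inv k
          0≡inv-k = begin
            0ℚ        ≡⟨ scaledIndicator-∉ (inv k) (x∉p-x X y) ⟨
            σ y       ≡⟨ σ≡ρ y ⟩
            ρ y       ≡⟨ ρ≗θ y ⟩
            θ y       ≡⟨ scaledIndicator-∈ (inv k) y∈X ⟩
            inv k     ∎
            where open ≡-Reasoning

      -- Otherwise θ is a proper convex combination of the scaled indicators of Z and X ∖ Z.
      nonempty-separator-is-X : ∀ {Z z} → IsSeparatorOfContr M X Z → z ∈ Z → X ⊆ Z
      nonempty-separator-is-X {Z} {z} (Z⊆X , separates) z∈Z {w} w∈X = decidable-stable (w ∈? Z) w∈Z-forced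
        where
        a+b≡k : contrRank M X Z ℕ.+ contrRank M X (X ∩ ∁ Z) ≡ k
        a+b≡k = trans (M/∁X.separator-rank Z⊆X (λ C C⊆X C-circuit → separates C (C⊆X , C-circuit))) rank-X
        w∈Z-forced : ¬ w ∉ Z
        w∈Z-forced w∉Z = ℚ.<-irrefl (sym inv-a≡0) (inv-pos a)
          where
          a b : ℕ
          a = contrRank M X Z
          b = contrRank M X (X ∩ ∁ Z)
          instance
            a≢0 : NonZero a
            a≢0 = ℕ.>-nonZero (closed-contraction-rank-pos θ-extreme⇒closed (Z⊆X z∈Z) z∈Z)
            b≢0 : NonZero b
            b≢0 = ℕ.>-nonZero (closed-contraction-rank-pos θ-extreme⇒closed w∈X (x∈p∩q⁺ (w∈X , x∉p⇒x∈∁p w∉Z)))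
          t : ℚ
          t = inv k ℚ.* fromℕ a
          t>0 : 0ℚ ℚ.< t
          t>0 = *-pos (inv-pos k) (fromℕ-pos a)
          t<1 : t ℚ.< 1ℚ
          t<1 = 0<q-p⇒p<q (subst (0ℚ ℚ.<_) (sym (complementary-weight a+b≡k)) (*-pos (inv-pos k) (fromℕ-pos b)))
          inv-a≡0 : inv a ≡ 0ℚ
          inv-a≡0 = begin
            inv a                                   ≡⟨ scaledIndicator-∈ (inv a) z∈Z ⟨
            scaledIndicator (inv a) Z z             ≡⟨ proj₂ ρ-extreme _ _ t
                                                         (Adm-part a+b≡k (∁q⊆[p∩∁q]∪∁p X Z))
                                                         (Adm-part (trans (ℕ.+-comm b a) a+b≡k) (∁[p∩∁q]⊆q∪∁p X Z))
                                                         t>0 t<1 (λ e → trans (ρ≗θ e) (θ-split Z⊆X a+b≡k e)) z ⟩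
            scaledIndicator (inv b) (X ∩ ∁ Z) z     ≡⟨ scaledIndicator-∉ (inv b)
                                                         (λ z∈Z′ → x∈∁p⇒x∉p (proj₂ (x∈p∩q⁻ X (∁ Z) z∈Z′)) z∈Z) ⟩
            0ℚ                                      ∎
            where open ≡-Reasoning

      θ-extreme⇒connected : ContrConnected M X
      θ-extreme⇒connected Z Z-separator with ⊆-or-witness Z ⊥
      ... | inj₁ Z⊆⊥ = inj₁ (⊆-antisym Z⊆⊥ ⊥⊆)
      ... | inj₂ (z , z∈Z , _) = inj₂ (⊆-antisym (proj₁ Z-separator) (nonempty-separator-is-X Z-separator z∈Z))

  module Extreme {ρ : Fin n → ℚ} (ρ-extreme : IsExtremePoint (Adm M) ρ) where

    X : Subset n
    X = satisfying (λ e → ¬? (ρ e ℚ.≟ 0ℚ))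

    open Candidate X

    ρ≥0 : ∀ e → 0ℚ ℚ.≤ ρ e
    ρ≥0 = proj₁ (proj₁ ρ-extreme)

    ρ-outside : ∀ {e} → e ∉ X → ρ e ≡ 0ℚ
    ρ-outside {e} e∉X = decidable-stable (ρ e ℚ.≟ 0ℚ) (e∉X ∘ ∈-satisfying⁺ (λ e → ¬? (ρ e ℚ.≟ 0ℚ)))

    ρ-inside : ∀ {e} → e ∈ X → 0ℚ ℚ.< ρ e
    ρ-inside {e} e∈X = ℚ.≰⇒> λ ρe≤0 → ∈-satisfying⁻ (λ e → ¬? (ρ e ℚ.≟ 0ℚ)) e∈X (ℚ.≤-antisym ρe≤0 (ρ≥0 e))

    X-nonempty : Nonempty X
    X-nonempty = decidable-stable (nonempty? X) λ X-empty →
      from-no (1ℚ ℚ.≤? 0ℚ) (subst (1ℚ ℚ.≤_)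
        (sumOver-zero B₀ (λ _ → ρ-outside (λ e∈X → X-empty (_ , e∈X))))
        (proj₂ (proj₁ ρ-extreme) B₀ (basis-of-⊤⇒base (proj₂ (basis-exists ⊤)))))
      where
      B₀ : Subset n
      B₀ = proj₁ (basis-exists ⊤)

    e₀ : Fin n
    e₀ = proj₁ (minimum-on ρ X-nonempty)

    e₀∈X : e₀ ∈ X
    e₀∈X = proj₁ (proj₂ (minimum-on ρ X-nonempty))

    v : ℚ
    v = ρ e₀

    v≤ρ : ∀ {e} → e ∈ X → v ℚ.≤ ρ e
    v≤ρ = proj₂ (proj₂ (minimum-on ρ X-nonempty))

    ρ′ : Fin n → ℚ
    ρ′ e = ρ e ℚ.- scaledIndicator v X e

    ρ′≥0 : ∀ e → 0ℚ ℚ.≤ ρ′ e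
    ρ′≥0 e with e ∈? X
    ... | yes e∈X = subst (λ s → 0ℚ ℚ.≤ ρ e ℚ.- s) (sym (scaledIndicator-∈ v e∈X)) (0≤q-p (v≤ρ e∈X))
    ... | no  e∉X = subst (λ s → 0ℚ ℚ.≤ ρ e ℚ.- s) (sym (scaledIndicator-∉ v e∉X)) (0≤q-p (ρ≥0 e))

    ρ′≤ρ : ∀ e → ρ′ e ℚ.≤ ρ e
    ρ′≤ρ e = p-q≤p (scaledIndicator-nonNeg {X = X} (ℚ.<⇒≤ (ρ-inside e₀∈X)) e)

    ρ′e₀≡0 : ρ′ e₀ ≡ 0ℚ
    ρ′e₀≡0 = trans (cong (λ s → v ℚ.- s) (scaledIndicator-∈ v e₀∈X)) (ℚ.+-inverseʳ v)

    ρ-decomposition : ∀ e → ρ e ≡ scaledIndicator v X e ℚ.+ ρ′ e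
    ρ-decomposition e = add-back (ρ e) (scaledIndicator v X e)
      where
      add-back : ∀ x y → x ≡ y ℚ.+ (x ℚ.- y)
      add-back = solve 2 (λ x y → x := y :+ (x :- y)) refl

    -- B ∩ X contains a basis J of X in M/∁X, and J ∪ I₀ is a base.
    residual-bound : ∀ {B} → IsBase M B → 1ℚ ℚ.- v ℚ.* fromℕ k ℚ.≤ sumOver B ρ′
    residual-bound {B} B-base = p≤q+r⇒p-q≤r {q = v ℚ.* fromℕ k} (begin
      1ℚ                                                   ≤⟨ proj₂ (proj₁ ρ-extreme) (J ∪ I₀) J∪I₀-base ⟩
      sumOver (J ∪ I₀) ρ                                   ≡⟨ sumOver-∪I₀ ρ ρ-outside J⊆X ⟩
      sumOver J ρ                                          ≡⟨ sumOver-cong J (λ {e} _ → ρ-decomposition e) ⟩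
      sumOver J (λ e → scaledIndicator v X e ℚ.+ ρ′ e)     ≡⟨ sumOver-+ J (scaledIndicator v X) ρ′ ⟩
      sumOver J (scaledIndicator v X) ℚ.+ sumOver J ρ′     ≡⟨ cong (ℚ._+ sumOver J ρ′) sum-J≡v*k ⟩
      v ℚ.* fromℕ k ℚ.+ sumOver J ρ′                       ≤⟨ ℚ.+-monoʳ-≤ (v ℚ.* fromℕ k)
                                                                (sumOver-⊆-mono ρ′ ρ′≥0 J⊆B) ⟩
      v ℚ.* fromℕ k ℚ.+ sumOver B ρ′                       ∎)
      where
      open ℚ.≤-Reasoning
      J : Subset n
      J = proj₁ (M/∁X.basis-exists (B ∩ X))
      J-basis : M/∁X.IsBasisOf J (B ∩ X)
      J-basis = proj₂ (M/∁X.basis-exists (B ∩ X))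
      J⊆X : J ⊆ X
      J⊆X = p∩q⊆q B X ∘ M/∁X.IsBasisOf.⊆-set J-basis
      J⊆B : J ⊆ B
      J⊆B = p∩q⊆p B X ∘ M/∁X.IsBasisOf.⊆-set J-basis
      ∣J∣≡k : ∣ J ∣ ≡ k
      ∣J∣≡k = trans (sym (M/∁X.IsBasisOf.independent J-basis))
                    (trans (M/∁X.IsBasisOf.spanning J-basis) (rank-base-∩ B-base))
      J∪I₀-base : IsBase M (J ∪ I₀)
      J∪I₀-base = tight-base J⊆X (M/∁X.IsBasisOf.independent J-basis) ∣J∣≡k
      sum-J≡v*k : sumOver J (scaledIndicator v X) ≡ v ℚ.* fromℕ k
      sum-J≡v*k = trans (sumOver-const J v (scaledIndicator-∈ v ∘ J⊆X)) (cong (λ m → v ℚ.* fromℕ m) ∣J∣≡k)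

    -- Otherwise ρ′ itself is admissible.
    k≢0 : k ≢ 0
    k≢0 k≡0 = ℚ.<-irrefl (trans (sym ρ′e₀≡0) ρ′e₀≡v) (ρ-inside e₀∈X)
      where
      ρ′-admissible : Adm M ρ′
      ρ′-admissible = ρ′≥0 , λ B B-base →
        subst (ℚ._≤ sumOver B ρ′)
              (trans (cong (λ m → 1ℚ ℚ.- v ℚ.* fromℕ m) k≡0) (cong (λ s → 1ℚ ℚ.- s) (ℚ.*-zeroʳ v)))
              (residual-bound B-base)
      ρ′e₀≡v : ρ′ e₀ ≡ v
      ρ′e₀≡v = extreme-minimal Adm-upwardClosed ρ-extreme ρ′-admissible ρ′≤ρ e₀

    instance
      k-nonZero : NonZero k
      k-nonZero = ℕ.≢-nonZero k≢0

    t : ℚ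
    t = v ℚ.* fromℕ k

    module _ (t<1 : t ℚ.< 1ℚ) where
      private
        1-t>0 : 0ℚ ℚ.< 1ℚ ℚ.- t
        1-t>0 = 0<q-p t<1
        instance
          1-t≢0 : ℚ.NonZero (1ℚ ℚ.- t)
          1-t≢0 = ℚ.>-nonZero 1-t>0
        1/[1-t]≥0 : 0ℚ ℚ.≤ 1/ (1ℚ ℚ.- t)
        1/[1-t]≥0 = ℚ.<⇒≤ (ℚ.positive⁻¹ _ {{ℚ.1/pos⇒pos (1ℚ ℚ.- t) {{ℚ.positive 1-t>0}}}})

      σ : Fin n → ℚ
      σ e = 1/ (1ℚ ℚ.- t) ℚ.* ρ′ e

      σ-admissible : Adm M σ
      σ-admissible = (λ e → *-nonNeg 1/[1-t]≥0 (ρ′≥0 e)) , λ B B-base → begin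
        1ℚ                                ≡⟨ ℚ.*-inverseˡ (1ℚ ℚ.- t) ⟨
        1/ (1ℚ ℚ.- t) ℚ.* (1ℚ ℚ.- t)      ≤⟨ ℚ.*-monoˡ-≤-nonNeg (1/ (1ℚ ℚ.- t)) {{ℚ.nonNegative 1/[1-t]≥0}}
                                               (residual-bound B-base) ⟩
        1/ (1ℚ ℚ.- t) ℚ.* sumOver B ρ′    ≡⟨ sumOver-*ˡ B (1/ (1ℚ ℚ.- t)) ρ′ ⟨
        sumOver B σ                       ∎
        where open ℚ.≤-Reasoning

      ρ≡tθ+[1-t]σ : ∀ e → ρ e ≡ t ℚ.* θ e ℚ.+ (1ℚ ℚ.- t) ℚ.* σ e
      ρ≡tθ+[1-t]σ e = trans (ρ-decomposition e) (cong₂ ℚ._+_ v-part (sym ρ′-part))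
        where
        open ≡-Reasoning
        v-part : scaledIndicator v X e ≡ t ℚ.* θ e
        v-part = trans (cong (λ c → scaledIndicator c X e) (sym (*-fromℕ-*-inv v k)))
                       (scaledIndicator-*ˡ t (inv k) X e)
        ρ′-part : (1ℚ ℚ.- t) ℚ.* σ e ≡ ρ′ e
        ρ′-part = begin
          (1ℚ ℚ.- t) ℚ.* (1/ (1ℚ ℚ.- t) ℚ.* ρ′ e)    ≡⟨ ℚ.*-assoc (1ℚ ℚ.- t) (1/ (1ℚ ℚ.- t)) (ρ′ e) ⟨
          (1ℚ ℚ.- t) ℚ.* 1/ (1ℚ ℚ.- t) ℚ.* ρ′ e      ≡⟨ cong (ℚ._* ρ′ e) (ℚ.*-inverseʳ (1ℚ ℚ.- t)) ⟩
          1ℚ ℚ.* ρ′ e                                ≡⟨ ℚ.*-identityˡ (ρ′ e) ⟩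
          ρ′ e                                       ∎

      σe₀≡0 : σ e₀ ≡ 0ℚ
      σe₀≡0 = trans (cong (1/ (1ℚ ℚ.- t) ℚ.*_) ρ′e₀≡0) (ℚ.*-zeroʳ (1/ (1ℚ ℚ.- t)))

    -- Otherwise ρ = t θ + (1 − t) σ is a proper convex combination, but σ vanishes at e₀ and θ does not.
    1≤t : 1ℚ ℚ.≤ t
    1≤t = ℚ.≮⇒≥ λ t<1 → ℚ.<-irrefl (begin
      0ℚ          ≡⟨ σe₀≡0 t<1 ⟨
      σ t<1 e₀    ≡⟨ proj₂ ρ-extreme θ (σ t<1) t θ-admissible (σ-admissible t<1)
                       (*-pos (ρ-inside e₀∈X) (fromℕ-pos k)) t<1 (ρ≡tθ+[1-t]σ t<1) e₀ ⟨
      θ e₀        ≡⟨ scaledIndicator-∈ (inv k) e₀∈X ⟩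
      inv k       ∎) (inv-pos k)
      where open ≡-Reasoning

    θ≤ρ : ∀ e → θ e ℚ.≤ ρ e
    θ≤ρ e with e ∈? X
    ... | yes e∈X = subst (ℚ._≤ ρ e) (sym (scaledIndicator-∈ (inv k) e∈X)) (ℚ.≤-trans (inv-≤ k 1≤t) (v≤ρ e∈X))
    ... | no  e∉X = subst (ℚ._≤ ρ e) (sym (θ-outside e∉X)) (ρ≥0 e)

    ρ≗θ : ∀ e → ρ e ≡ θ e
    ρ≗θ e = sym (extreme-minimal Adm-upwardClosed ρ-extreme θ-admissible θ≤ρ e)

    extreme⇒InΘ : InΘ M ρ
    extreme⇒InΘ = X , X-nonempty , closed⇒cl-fixed (θ-extreme⇒closed ρ-extreme ρ≗θ) ,
                  θ-extreme⇒connected ρ-extreme ρ≗θ , ρ≗θ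

theorem6p2 : (n : ℕ) (M : Matroid n) → Loopless M → 0 < Matroid.r M ⊤ →
    (ρ : Fin n → ℚ) →
    (IsExtremePoint (Adm M) ρ → InΘ M ρ) × (InΘ M ρ → IsExtremePoint (Adm M) ρ)
theorem6p2 n M _ _ ρ =
  Extreme.extreme⇒InΘ ,
  (λ (X , X-nonempty , cl-fixed , connected , ρ≗θ) →
     Candidate.θ-extreme X X-nonempty (cl-fixed⇒closed cl-fixed) connected ρ≗θ)
  where
  open Blocker M
  open MatroidTheory M
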